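{- There is a bijection $\Phi$ from $\mathbb{F}(3,3)$ onto $\mathbb{C}(3,3)$ such that for every pair $(\pi,\zeta)\in\mathbb{F}(3,3)$, the partition $\omega=\Phi(\pi,\zeta)\in\mathbb{C}(3,3)$ satisfies \[|\omega|=|\pi|+|\zeta|\quad\text{and}\quad \ell(\omega)=\ell(\pi)+\ell(\zeta).\]
   Context: A partition is a finite non-increasing sequence of positive integers (the empty partition included); $|\pi|$ is the sum of parts and $\ell(\pi)$ the number of parts. $\mathbb{C}(3,3)$ is the set of partitions $\pi=(\pi_1,\dots,\pi_\ell)$ with no repeated odd part, $\pi_i\ge\pi_{i+2}+2$ for $1\le i\le\ell-2$ (strict if $\pi_i$ is even), and at most $2$ parts $\le2$. $\mathbb{E}(3,3)$ is the set of partitions in $\mathbb{C}(3,3)$ having no odd parts. Göllnitz–Gordon marking $GG(\pi)$: marks (positive integers) are assigned to the parts from smallest to largest, each as small as possible subject to: the mark of $\pi_i$ differs from the marks of all parts $\pi_g$, $g>i$, with $\pi_i-\pi_g\le2$ (strict if $\pi_i$ odd). $N_2(\pi)$ denotes the number of parts with mark $2$ in $GG(\pi)$. For $N\ge0$, $\mathbb{I}_N$ is the set of partitions into distinct odd parts, each part $\ge2N+1$. $\mathbb{F}(3,3)$ is the set of pairs $(\pi,\zeta)$ with $\pi\in\mathbb{E}(3,3)$ and $\zeta\in\mathbb{I}_{N_2(\pi)}$. -}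

module Defs where

open import Data.Nat using (ℕ; zero; suc; _+_; _∸_; _≤ᵇ_; _<ᵇ_; _≡ᵇ_; _%_)
open import Data.Bool using (Bool; true; false; _∧_; _∨_; not; if_then_else_; T)
open import Data.List using (List; []; _∷_; length; reverse; map; filter; foldr)
open import Data.Nat.ListAction using (sum)
open import Data.Product using (_×_; _,_; proj₁; proj₂)
open import Relation.Nullary.Decidable using (does)
open import Data.Nat using (_≤?_; _≟_)

-- A partition is represented by the list (π₁, π₂, …, π_ℓ) of its parts,
-- listed in non-increasing order, all parts positive.

isEven : ℕ → Bool
isEven n = n % 2 ≡ᵇ 0

isOdd : ℕ → Bool
isOdd n = not (isEven n)

isPartition : List ℕ → Bool
isPartition [] = true
isPartition (a ∷ []) = 1 ≤ᵇ a
isPartition (a ∷ b ∷ rest) = (b ≤ᵇ a) ∧ isPartition (b ∷ rest)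

size : List ℕ → ℕ
size = sum

len : List ℕ → ℕ
len = length

-- no repeated odd part (for a non-increasing list, equal parts are adjacent)
noRepeatedOdd : List ℕ → Bool
noRepeatedOdd [] = true
noRepeatedOdd (a ∷ []) = true
noRepeatedOdd (a ∷ b ∷ rest) = not ((a ≡ᵇ b) ∧ isOdd a) ∧ noRepeatedOdd (b ∷ rest)

gapCond : List ℕ → Bool
gapCond (a ∷ b ∷ c ∷ rest) =
  (if isEven a then (c + 2 <ᵇ a) else (c + 2 ≤ᵇ a)) ∧ gapCond (b ∷ c ∷ rest)
gapCond _ = true

smallParts : List ℕ → ℕ
smallParts π = length (filter (λ x → x ≤? 2) π)

isC33 : List ℕ → Bool
isC33 π = isPartition π ∧ noRepeatedOdd π ∧ gapCond π ∧ (smallParts π ≤ᵇ 2)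

allEven : List ℕ → Bool
allEven [] = true
allEven (a ∷ rest) = isEven a ∧ allEven rest

isE33 : List ℕ → Bool
isE33 π = isC33 π ∧ allEven π

memberℕ : ℕ → List ℕ → Bool
memberℕ k [] = false
memberℕ k (x ∷ xs) = (k ≡ᵇ x) ∨ memberℕ k xs

firstFree : ℕ → ℕ → List ℕ → ℕ
firstFree zero k fs = k
firstFree (suc f) k fs = if memberℕ k fs then firstFree f (suc k) fs else k

-- least positive integer not in the list (fuel = length suffices)
mex₁ : List ℕ → ℕ
mex₁ fs = firstFree (length fs) 1 fs

conflicts : ℕ → ℕ → Bool
conflicts p q = if isOdd p then (p ∸ q <ᵇ 2) else (p ∸ q ≤ᵇ 2)

forbiddenMarks : ℕ → List (ℕ × ℕ) → List ℕ
forbiddenMarks p [] = []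
forbiddenMarks p ((q , m) ∷ done) =
  if conflicts p q then m ∷ forbiddenMarks p done else forbiddenMarks p done

-- process the parts from smallest to largest (input list ascending);
-- the accumulator holds the already-marked (part , mark) pairs
markAsc : List (ℕ × ℕ) → List ℕ → List (ℕ × ℕ)
markAsc done [] = done
markAsc done (p ∷ ps) = markAsc ((p , mex₁ (forbiddenMarks p done)) ∷ done) ps

GG : List ℕ → List (ℕ × ℕ)
GG π = markAsc [] (reverse π)

N₂ : List ℕ → ℕ
N₂ π = length (filter (λ pm → proj₂ pm ≟ 2) (GG π))

strictlyDecreasing : List ℕ → Bool
strictlyDecreasing [] = true
strictlyDecreasing (a ∷ []) = true
strictlyDecreasing (a ∷ b ∷ rest) = (b <ᵇ a) ∧ strictlyDecreasing (b ∷ rest)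

allOddAtLeast : ℕ → List ℕ → Bool
allOddAtLeast m [] = true
allOddAtLeast m (a ∷ rest) = isOdd a ∧ (m ≤ᵇ a) ∧ allOddAtLeast m rest

isI : ℕ → List ℕ → Bool
isI N ζ = isPartition ζ ∧ strictlyDecreasing ζ ∧ allOddAtLeast (2 * N + 1) ζ
  where open import Data.Nat using (_*_)

isF33 : List ℕ × List ℕ → Bool
isF33 (π , ζ) = isE33 π ∧ isI (N₂ π) ζ

InC33 : List ℕ → Set
InC33 ω = T (isC33 ω)

InF33 : List ℕ × List ℕ → Set
InF33 x = T (isF33 x)

{-# OPTIONS --safe #-}
module Submission where

-- Parts are stored by level: ev a is the part 2a and od a the part 2a + 1. In these terms every
-- condition of ℂ(3,3) compares levels, and "at most two parts ≤ 2" follows from the gap condition.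
--
-- Φ(π , ζ) inserts the odd parts 2k + 1 of ζ into π, smallest first. Inserting 2k + 1 walks down
-- the even parts: a close pair 2a, 2b (a ∈ {b, b + 1}, paired greedily from the top) with b ≥ k is
-- replaced by 2b + 2, 2a and the walk continues with k − 1; a single even part 2a > 2k + 1 is
-- passed; otherwise 2k + 1 is placed there. The threshold of a partition, the number of close pairs
-- above its largest odd part 2a + 1 plus a + 1, then becomes k + 1. So the odd parts of ζ can be
-- inserted in increasing order when the smallest is at least 2 threshold(π) + 1, and for
-- even π the threshold is N₂(π). Insertion is undone by removing the largest odd part 2x + 1 and
-- lowering each part of Göllnitz–Gordon mark 2 above it together with the part below it,
-- 2a, 2b ↦ 2b, 2a − 2; the removed part had been inserted with k = x + threshold.

open import Defs
open import Data.Nat using (ℕ; zero; suc; _+_; _*_; _∸_; _≤_; _<_; z≤n; s≤s; pred; _≤?_; _<?_; _≟_; _≤ᵇ_; _<ᵇ_; _≡ᵇ_)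
open import Data.Nat.Properties
open import Data.Nat.ListAction using (sum)
open import Data.Nat.Tactic.RingSolver using (solve-∀)
open import Data.List using (List; []; _∷_; _++_; length; map; reverse)
open import Data.List.Properties using (∷-injective; length-++; length-map; length-filter; unfold-reverse)
open import Data.List.Relation.Unary.All using (All; []; _∷_)
open import Data.Bool using (Bool; true; false; not; _∧_; if_then_else_; T)
open import Data.Bool.Properties using (∧-zeroʳ; ∧-conicalˡ; ∧-conicalʳ; not-injective; T-∧; T-not-≡)
open import Data.Maybe using (Maybe; nothing; just)
open import Data.Product using (Σ; ∃; _×_; _,_; proj₁; proj₂)
open import Data.Sum using (_⊎_; inj₁; inj₂; [_,_]′)
open import Data.Unit using (⊤; tt)
open import Data.Empty using (⊥; ⊥-elim)
open import Function using (_∘_)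
open import Function.Bundles using (Equivalence)
open import Relation.Nullary using (Dec; yes; no; ¬_; does; contradiction)
open import Relation.Nullary.Decidable using (dec-true; dec-false)
open import Relation.Binary.PropositionalEquality using (_≡_; _≢_; refl; sym; trans; cong; cong₂; subst)
open Relation.Binary.PropositionalEquality.≡-Reasoning

data Part : Set where
  ev od : ℕ → Part

value : Part → ℕ
value (ev a) = a + a
value (od a) = suc (a + a)

level : Part → ℕ
level (ev a) = a
level (od a) = a

Adjacent : Part → Part → Set
Adjacent x (ev b) = b ≤ level x
Adjacent x (od b) = b < level x

Gap : Part → Part → Set
Gap (ev a) z = 2 + level z ≤ a
Gap (od a) z = 1 + level z ≤ a

Positive : Part → Set
Positive (ev a) = 1 ≤ a
Positive (od _) = ⊤

OnTop : {A : Set} → (Part → A → Set) → Maybe Part → A → Set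
OnTop R nothing  _ = ⊤
OnTop R (just x) y = R x y

-- ValidUnder c₂ c₁ L: L placed directly below c₁, which lies directly below c₂.
ValidUnder : Maybe Part → Maybe Part → List Part → Set
ValidUnder c₂ c₁ []      = ⊤
ValidUnder c₂ c₁ (x ∷ L) = OnTop Adjacent c₁ x × OnTop Gap c₂ x × Positive x × ValidUnder c₁ (just x) L

Valid : List Part → Set
Valid = ValidUnder nothing nothing

AllEven : List Part → Set
AllEven []         = ⊤
AllEven (ev _ ∷ L) = AllEven L
AllEven (od _ ∷ L) = ⊥

AdjacentHead : Part → List Part → Set
AdjacentHead x []      = ⊤
AdjacentHead x (y ∷ _) = Adjacent x y

GapHead : Part → List Part → Set
GapHead x []      = ⊤
GapHead x (y ∷ _) = Gap x y

GapSecond : Part → List Part → Set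
GapSecond x []      = ⊤
GapSecond x (_ ∷ Y) = GapHead x Y

valid-cons : ∀ x Y → Valid Y → Positive x → AdjacentHead x Y → GapSecond x Y → Valid (x ∷ Y)
valid-cons x []          _                         p _ _ = tt , tt , p , tt
valid-cons x (y ∷ [])    (_ , _ , py , _)          p a _ = tt , tt , p , a , tt , py , tt
valid-cons x (y ∷ z ∷ Y) (_ , _ , py , az , _ , v) p a g = tt , tt , p , a , tt , py , az , g , v

valid-under : ∀ {c₂ c₁} x L → Valid (x ∷ L) →
  OnTop Adjacent c₁ x → OnTop Gap c₂ x → OnTop GapHead c₁ L → ValidUnder c₂ c₁ (x ∷ L)
valid-under x []      (_ , _ , p , _)              a g _ = a , g , p , tt
valid-under {c₁ = nothing} x (y ∷ L) (_ , _ , p , ay , _ , py , v) a g _ = a , g , p , ay , tt , py , v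
valid-under {c₁ = just _}  x (y ∷ L) (_ , _ , p , ay , _ , py , v) a g h = a , g , p , ay , h , py , v

forget-second : ∀ {c₂ c₁} L → ValidUnder c₂ c₁ L → ValidUnder nothing c₁ L
forget-second []      _               = tt
forget-second (x ∷ L) (a , _ , p , v) = a , tt , p , v

valid-tail : ∀ x L → Valid (x ∷ L) → Valid L
valid-tail x []      _                    = tt
valid-tail x (y ∷ L) (_ , _ , _ , _ , _ , p , v) = tt , tt , p , forget-second L v

valid-positive : ∀ x L → Valid (x ∷ L) → Positive x
valid-positive x L (_ , _ , p , _) = p

valid-adjacent : ∀ x y L → Valid (x ∷ y ∷ L) → Adjacent x y
valid-adjacent x y L (_ , _ , _ , a , _) = a

valid-gap : ∀ x y z L → Valid (x ∷ y ∷ z ∷ L) → Gap x z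
valid-gap x y z L (_ , _ , _ , _ , _ , _ , _ , g , _) = g

valid-adjacentHead : ∀ x Y → Valid (x ∷ Y) → AdjacentHead x Y
valid-adjacentHead x []      _ = tt
valid-adjacentHead x (y ∷ Y) v = valid-adjacent x y Y v

valid-gapSecond : ∀ x Y → Valid (x ∷ Y) → GapSecond x Y
valid-gapSecond x []          _ = tt
valid-gapSecond x (y ∷ [])    _ = tt
valid-gapSecond x (y ∷ z ∷ Y) v = valid-gap x y z Y v

adjacent⇒level≤ : ∀ x y → Adjacent x y → level y ≤ level x
adjacent⇒level≤ x (ev b) a = a
adjacent⇒level≤ x (od b) a = <⇒≤ a

Close : ℕ → ℕ → Set
Close a b = a ≡ b ⊎ a ≡ suc b

close? : ∀ a b → Dec (Close a b)
close? a b with a ≟ b | a ≟ suc b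
... | yes a≡b | _        = yes (inj₁ a≡b)
... | no _    | yes a≡1+b = yes (inj₂ a≡1+b)
... | no a≢b  | no a≢1+b  = no [ a≢b , a≢1+b ]′

close⇒≤ : ∀ {a b} → Close a b → b ≤ a
close⇒≤ (inj₁ refl) = ≤-refl
close⇒≤ (inj₂ refl) = n≤1+n _

close⇒≤suc : ∀ {a b} → Close a b → a ≤ suc b
close⇒≤suc (inj₁ refl) = n≤1+n _
close⇒≤suc (inj₂ refl) = ≤-refl

≤∧¬close⇒2+≤ : ∀ {a c} → c ≤ a → ¬ Close a c → 2 + c ≤ a
≤∧¬close⇒2+≤ c≤a ¬close = ≤∧≢⇒< (≤∧≢⇒< c≤a (¬close ∘ inj₁ ∘ sym)) (¬close ∘ inj₂ ∘ sym)

2+≤⇒¬close : ∀ {a c} → 2 + c ≤ a → ¬ Close a c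
2+≤⇒¬close h (inj₁ refl) = 1+n≰n (≤-trans (n≤1+n _) h)
2+≤⇒¬close h (inj₂ refl) = 1+n≰n h

close-raise : ∀ {a b} → Close a b → Close (suc b) a
close-raise (inj₁ refl) = inj₂ refl
close-raise (inj₂ refl) = inj₁ refl

close-lower : ∀ {a b} → Close (suc a) b → Close b a
close-lower (inj₁ refl) = inj₂ refl
close-lower (inj₂ refl) = inj₁ refl

HeadApart : ℕ → List Part → Set
HeadApart a (ev b ∷ _) = ¬ Close a b
HeadApart a _          = ⊤

-- Inserting an odd part

data Shape : List Part → Set where
  nil    : Shape []
  odd    : ∀ a L → Shape (od a ∷ L)
  pair   : ∀ a b L → Close a b → Shape (ev a ∷ ev b ∷ L)
  single : ∀ a L → HeadApart a L → Shape (ev a ∷ L)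

shape : ∀ L → Shape L
shape []                 = nil
shape (od a ∷ L)         = odd a L
shape (ev a ∷ [])        = single a [] tt
shape (ev a ∷ od b ∷ L)  = single a (od b ∷ L) tt
shape (ev a ∷ ev b ∷ L) with close? a b
... | yes close = pair a b L close
... | no apart  = single a (ev b ∷ L) apart

raise : List Part → List Part
raise L with shape L
... | nil            = []
... | odd a L′       = od a ∷ raise L′
... | pair a b L′ _  = ev (suc b) ∷ ev a ∷ raise L′
... | single a L′ _  = ev a ∷ raise L′

threshold : List Part → ℕ
threshold L with shape L
... | nil            = 0
... | odd a _        = suc a
... | pair _ _ L′ _  = suc (threshold L′)
... | single _ L′ _  = threshold L′

insert : ℕ → List Part → List Part
insert k L with shape L
... | nil = od k ∷ []
... | odd a L′ = od k ∷ od a ∷ L′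
... | pair a b L′ _ with k ≤? b
...   | yes _ = ev (suc b) ∷ ev a ∷ insert (pred k) L′
...   | no _  = od k ∷ ev a ∷ ev b ∷ L′
insert k L | single a L′ _ with k <? a
...   | yes _ = ev a ∷ insert k L′
...   | no _  = od k ∷ ev a ∷ L′

-- insert-valid holds below even parts of levels c₁ (directly above) and c₂ (above c₁) satisfying these:
evenAbove : Maybe ℕ → Maybe Part
evenAbove nothing  = nothing
evenAbove (just q) = just (ev q)

EvenHeadRoom : Maybe ℕ → List Part → Set
EvenHeadRoom (just q) (ev a ∷ _) = 2 + a ≤ q
EvenHeadRoom _        _          = ⊤

PairRoom : Maybe ℕ → List Part → Set
PairRoom (just q) (ev a ∷ ev b ∷ _) = 3 + b ≤ q
PairRoom _        _                 = ⊤

Nested : Maybe ℕ → Maybe ℕ → Set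
Nested (just q₂) (just q₁) = q₁ ≤ q₂
Nested (just q₂) nothing   = ⊥
Nested nothing   _         = ⊤

headRoom-pair : ∀ a b r → Valid (ev a ∷ ev b ∷ r) → EvenHeadRoom (just a) r
headRoom-pair a b []         _ = tt
headRoom-pair a b (od c ∷ r) _ = tt
headRoom-pair a b (ev c ∷ r) v = valid-gap (ev a) (ev b) (ev c) r v

headRoom-single : ∀ a r → HeadApart a r → Valid (ev a ∷ r) → EvenHeadRoom (just a) r
headRoom-single a []         _     _ = tt
headRoom-single a (od c ∷ r) _     _ = tt
headRoom-single a (ev c ∷ r) apart v = ≤∧¬close⇒2+≤ (valid-adjacent (ev a) (ev c) r v) apart

odd-under : ∀ c₂ c₁ k L → Valid (od k ∷ L) →
  OnTop Adjacent (evenAbove c₁) (od k) → OnTop Gap (evenAbove c₂) (od k) → EvenHeadRoom c₁ L →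
  ValidUnder (evenAbove c₂) (evenAbove c₁) (od k ∷ L)
odd-under c₂ c₁ k L v k<q₁ gap room = valid-under {evenAbove c₂} (od k) L v k<q₁ gap (headGap c₁ L v k<q₁ room)
  where
  headGap : ∀ c₁ L → Valid (od k ∷ L) → OnTop Adjacent (evenAbove c₁) (od k) → EvenHeadRoom c₁ L →
            OnTop GapHead (evenAbove c₁) L
  headGap nothing  L          _ _    _    = tt
  headGap (just q) []         _ _    _    = tt
  headGap (just q) (ev a ∷ L) _ _    room = room
  headGap (just q) (od a ∷ L) v k<q₁ _    = ≤-trans (s≤s (valid-adjacent (od k) (od a) L v)) k<q₁

pair-under : ∀ c₂ c₁ a b r R → Close a b → Valid (ev a ∷ ev b ∷ r) →
  EvenHeadRoom c₁ (ev a ∷ ev b ∷ r) → PairRoom c₂ (ev a ∷ ev b ∷ r) →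
  ValidUnder (just (ev (suc b))) (just (ev a)) R →
  ValidUnder (evenAbove c₂) (evenAbove c₁) (ev (suc b) ∷ ev a ∷ R)
pair-under c₂ c₁ a b r R close v room pairRoom vR =
  adjacent c₁ room , gap c₂ pairRoom , s≤s z≤n , close⇒≤suc close , gapA c₁ room ,
  valid-positive (ev a) _ v , vR
  where
  adjacent : ∀ c₁ → EvenHeadRoom c₁ (ev a ∷ ev b ∷ r) → OnTop Adjacent (evenAbove c₁) (ev (suc b))
  adjacent nothing  _    = tt
  adjacent (just q) room = ≤-trans (s≤s (close⇒≤ close)) (≤-trans (n≤1+n _) room)
  gap : ∀ c₂ → PairRoom c₂ (ev a ∷ ev b ∷ r) → OnTop Gap (evenAbove c₂) (ev (suc b))
  gap nothing  _        = tt
  gap (just q) pairRoom = pairRoom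
  gapA : ∀ c₁ → EvenHeadRoom c₁ (ev a ∷ ev b ∷ r) → OnTop Gap (evenAbove c₁) (ev a)
  gapA nothing  _    = tt
  gapA (just q) room = room

single-under : ∀ c₂ c₁ a r R → Valid (ev a ∷ r) → EvenHeadRoom c₁ (ev a ∷ r) → Nested c₂ c₁ →
  ValidUnder (evenAbove c₁) (just (ev a)) R → ValidUnder (evenAbove c₂) (evenAbove c₁) (ev a ∷ R)
single-under c₂ c₁ a r R v room nested vR = adjacent c₁ room , gap c₂ c₁ room nested , valid-positive (ev a) r v , vR
  where
  adjacent : ∀ c₁ → EvenHeadRoom c₁ (ev a ∷ r) → OnTop Adjacent (evenAbove c₁) (ev a)
  adjacent nothing  _    = tt
  adjacent (just q) room = ≤-trans (n≤1+n _) (≤-trans (n≤1+n _) room)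
  gap : ∀ c₂ c₁ → EvenHeadRoom c₁ (ev a ∷ r) → Nested c₂ c₁ → OnTop Gap (evenAbove c₂) (ev a)
  gap nothing   _         _    _      = tt
  gap (just q₂) nothing   _    ()
  gap (just q₂) (just q₁) room q₁≤q₂ = ≤-trans room q₁≤q₂

valid-odd-on-odd : ∀ k a r → Valid (od a ∷ r) → a < k → Valid (od k ∷ od a ∷ r)
valid-odd-on-odd k a r v a<k = valid-cons (od k) (od a ∷ r) v tt a<k (gapSecond r v)
  where
  gapSecond : ∀ r → Valid (od a ∷ r) → GapSecond (od k) (od a ∷ r)
  gapSecond []      _ = tt
  gapSecond (y ∷ r) v = ≤-trans (s≤s (adjacent⇒level≤ (od a) y (valid-adjacent (od a) y r v))) a<k

valid-odd-on-pair : ∀ k a b r → Valid (ev a ∷ ev b ∷ r) → Close a b → b < k → Valid (od k ∷ ev a ∷ ev b ∷ r)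
valid-odd-on-pair k a b r v close b<k = valid-cons (od k) _ v tt (≤-trans (close⇒≤suc close) b<k) b<k

valid-odd-on-single : ∀ k a r → Valid (ev a ∷ r) → HeadApart a r → a ≤ k → Valid (od k ∷ ev a ∷ r)
valid-odd-on-single k a r v apart a≤k = valid-cons (od k) _ v tt a≤k (gapSecond r apart v)
  where
  gapSecond : ∀ r → HeadApart a r → Valid (ev a ∷ r) → GapSecond (od k) (ev a ∷ r)
  gapSecond []         _     _ = tt
  gapSecond (od c ∷ r) _     v = ≤-trans (valid-adjacent (ev a) (od c) r v) a≤k
  gapSecond (ev c ∷ r) apart v =
    ≤-trans (n≤1+n _) (≤-trans (≤∧¬close⇒2+≤ (valid-adjacent (ev a) (ev c) r v) apart) a≤k)

pairRoom-pair : ∀ a b r → Valid (ev a ∷ ev b ∷ r) → PairRoom (just (suc b)) r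
pairRoom-pair a b (ev c ∷ ev d ∷ r) v =
  s≤s (valid-gap (ev b) (ev c) (ev d) r (valid-tail (ev a) (ev b ∷ ev c ∷ ev d ∷ r) v))
pairRoom-pair a b []                _ = tt
pairRoom-pair a b (od c ∷ r)        _ = tt
pairRoom-pair a b (ev c ∷ [])       _ = tt
pairRoom-pair a b (ev c ∷ od d ∷ r) _ = tt

pairRoom-single : ∀ c₁ a r → EvenHeadRoom c₁ (ev a ∷ r) → HeadApart a r → Valid (ev a ∷ r) → PairRoom c₁ r
pairRoom-single (just q) a (ev c ∷ ev d ∷ r) room apart v =
  ≤-trans (s≤s (s≤s (s≤s (valid-adjacent (ev c) (ev d) r (valid-tail (ev a) (ev c ∷ ev d ∷ r) v)))))
    (≤-trans (s≤s (≤∧¬close⇒2+≤ (valid-adjacent (ev a) (ev c) (ev d ∷ r) v) apart)) (≤-trans (n≤1+n _) room))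
pairRoom-single nothing  a _                 _ _ _ = tt
pairRoom-single (just q) a []                _ _ _ = tt
pairRoom-single (just q) a (od c ∷ r)        _ _ _ = tt
pairRoom-single (just q) a (ev c ∷ [])       _ _ _ = tt
pairRoom-single (just q) a (ev c ∷ od d ∷ r) _ _ _ = tt

headRoom⇒odd-gap : ∀ c₁ k a r → k < a → EvenHeadRoom c₁ (ev a ∷ r) → OnTop Gap (evenAbove c₁) (od k)
headRoom⇒odd-gap nothing  k a r _   _    = tt
headRoom⇒odd-gap (just q) k a r k<a room = ≤-trans (s≤s (s≤s (<⇒≤ k<a))) room

headRoom⇒nested : ∀ c₁ a r → EvenHeadRoom c₁ (ev a ∷ r) → Nested c₁ (just a)
headRoom⇒nested nothing  a r _    = tt
headRoom⇒nested (just q) a r room = ≤-trans (n≤1+n _) (≤-trans (n≤1+n _) room)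

insert-valid : ∀ k L c₂ c₁ → Valid L → threshold L ≤ k →
  OnTop Adjacent (evenAbove c₁) (od k) → OnTop Gap (evenAbove c₂) (od k) →
  EvenHeadRoom c₁ L → PairRoom c₂ L → Nested c₂ c₁ →
  ValidUnder (evenAbove c₂) (evenAbove c₁) (insert k L)
insert-valid k L c₂ c₁ v t k<q₁ gap room pairRoom nested with shape L
... | nil     = k<q₁ , gap , tt , tt
... | odd a r = odd-under c₂ c₁ k (od a ∷ r) (valid-odd-on-odd k a r v t) k<q₁ gap room
... | pair a b r close with k ≤? b
...   | no k≰b = odd-under c₂ c₁ k (ev a ∷ ev b ∷ r) (valid-odd-on-pair k a b r v close (≰⇒> k≰b)) k<q₁ gap room
insert-valid (suc k) L c₂ c₁ v (s≤s t) k<q₁ gap room pairRoom nested | pair a b r close | yes k<b =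
  pair-under c₂ c₁ a b r (insert k r) close v room pairRoom
    (insert-valid k r (just (suc b)) (just a) (valid-tail (ev b) r (valid-tail (ev a) (ev b ∷ r) v)) t
       (≤-trans k<b (close⇒≤ close)) (s≤s k<b) (headRoom-pair a b r v) (pairRoom-pair a b r v) (close⇒≤suc close))
insert-valid k L c₂ c₁ v t k<q₁ gap room pairRoom nested | single a r apart with k <? a
...   | no k≮a  = odd-under c₂ c₁ k (ev a ∷ r) (valid-odd-on-single k a r v apart (≮⇒≥ k≮a)) k<q₁ gap room
...   | yes k<a = single-under c₂ c₁ a r (insert k r) v room nested
  (insert-valid k r c₁ (just a) (valid-tail (ev a) r v) t k<a (headRoom⇒odd-gap c₁ k a r k<a room)
     (headRoom-single a r apart v) (pairRoom-single c₁ a r room apart v) (headRoom⇒nested c₁ a r room))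

threshold-pair : ∀ a b L → Close a b → threshold (ev a ∷ ev b ∷ L) ≡ suc (threshold L)
threshold-pair a b L close with close? a b
... | yes _     = refl
... | no apart = ⊥-elim (apart close)

threshold-apart : ∀ a b L → ¬ Close a b → threshold (ev a ∷ ev b ∷ L) ≡ threshold (ev b ∷ L)
threshold-apart a b L apart with close? a b
... | yes close = ⊥-elim (apart close)
... | no _      = refl

threshold-single : ∀ a L → HeadApart a L → threshold (ev a ∷ L) ≡ threshold L
threshold-single a []         _     = refl
threshold-single a (od b ∷ L) _     = refl
threshold-single a (ev b ∷ L) apart = threshold-apart a b L apart

threshold-cons-insert : ∀ c k L → Valid L → threshold L ≤ k → EvenHeadRoom (just c) L →
  threshold (ev c ∷ insert k L) ≡ threshold (insert k L)
threshold-cons-insert c k L v t room with shape L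
... | nil = refl
... | odd a r = refl
... | pair a b r close with k ≤? b
...   | no _ = refl
threshold-cons-insert c (suc k) L v (s≤s t) room | pair a b r close | yes _ = byCloseness (close? c (suc b))
  where
  byCloseness : Dec (Close c (suc b)) →
    threshold (ev c ∷ ev (suc b) ∷ ev a ∷ insert k r) ≡ threshold (ev (suc b) ∷ ev a ∷ insert k r)
  byCloseness (no apart)   = threshold-apart c (suc b) (ev a ∷ insert k r) apart
  byCloseness (yes close′) = begin
    threshold (ev c ∷ ev (suc b) ∷ ev a ∷ insert k r) ≡⟨ threshold-pair c (suc b) _ close′ ⟩
    suc (threshold (ev a ∷ insert k r))               ≡⟨ cong suc (threshold-cons-insert a k r vr t (headRoom-pair a b r v)) ⟩
    suc (threshold (insert k r))                      ≡⟨ threshold-pair (suc b) a _ (close-raise close) ⟨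
    threshold (ev (suc b) ∷ ev a ∷ insert k r)        ∎
    where
    vr : Valid r
    vr = valid-tail (ev b) r (valid-tail (ev a) (ev b ∷ r) v)
threshold-cons-insert c k L v t room | single a r _ with k <? a
...   | no _  = refl
...   | yes _ = threshold-apart c a (insert k r) (2+≤⇒¬close room)

threshold-insert : ∀ k L → Valid L → threshold L ≤ k → threshold (insert k L) ≡ suc k
threshold-insert k L v t with shape L
... | nil = refl
... | odd a r = refl
... | pair a b r close with k ≤? b
...   | no _ = refl
threshold-insert (suc k) L v (s≤s t) | pair a b r close | yes _ =
  trans (threshold-pair (suc b) a (insert k r) (close-raise close)) (cong suc (threshold-insert k r vr t))
  where
  vr : Valid r
  vr = valid-tail (ev b) r (valid-tail (ev a) (ev b ∷ r) v)
threshold-insert k L v t | single a r apart with k <? a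
...   | no _  = refl
...   | yes _ = trans (threshold-cons-insert a k r vr t (headRoom-single a r apart v)) (threshold-insert k r vr t)
  where
  vr : Valid r
  vr = valid-tail (ev a) r v

length-insert : ∀ k L → length (insert k L) ≡ suc (length L)
length-insert k L with shape L
... | nil = refl
... | odd a r = refl
... | pair a b r _ with k ≤? b
...   | yes _ = cong (λ n → suc (suc n)) (length-insert (pred k) r)
...   | no _  = refl
length-insert k L | single a r _ with k <? a
...   | yes _ = cong suc (length-insert k r)
...   | no _  = refl

total : List Part → ℕ
total L = sum (map value L)

total-insert : ∀ k L → threshold L ≤ k → total (insert k L) ≡ total L + value (od k)
total-insert k L t with shape L
... | nil = +-identityʳ (value (od k))
... | odd a r = +-comm (value (od k)) (total (od a ∷ r))
... | pair a b r _ with k ≤? b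
...   | no _ = +-comm (value (od k)) (total (ev a ∷ ev b ∷ r))
total-insert (suc k) L (s≤s t) | pair a b r _ | yes _ =
  trans (cong (λ n → value (ev (suc b)) + (value (ev a) + n)) (total-insert k r t)) (shift a b (total r) k)
  where
  shift : ∀ a b s k → (suc b + suc b) + ((a + a) + (s + suc (k + k))) ≡ ((a + a) + ((b + b) + s)) + suc (suc k + suc k)
  shift = solve-∀
total-insert k L t | single a r _ with k <? a
...   | no _  = +-comm (value (od k)) (total (ev a ∷ r))
...   | yes _ = trans (cong (value (ev a) +_) (total-insert k r t)) (sym (+-assoc (value (ev a)) (total r) (value (od k))))

-- Insertion is injective

-- For an even partition, markOne (x ∷ L) says that x has Göllnitz–Gordon mark 1 rather than 2.
markOne : List Part → Bool
markOne (ev a ∷ ev b ∷ L) = not (does (close? a b) ∧ markOne (ev b ∷ L))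
markOne _                 = true

lower : List Part → List Part
lower (ev a ∷ ev b ∷ L) =
  if does (close? a b) ∧ markOne (ev b ∷ L) then ev b ∷ ev (pred a) ∷ lower L else ev a ∷ lower (ev b ∷ L)
lower (x ∷ L) = x ∷ lower L
lower []      = []

raise-pair : ∀ a b U → Close a b → raise (ev a ∷ ev b ∷ U) ≡ ev (suc b) ∷ ev a ∷ raise U
raise-pair a b U close with close? a b
... | yes _    = refl
... | no apart = ⊥-elim (apart close)

raise-single : ∀ a U → HeadApart a U → raise (ev a ∷ U) ≡ ev a ∷ raise U
raise-single a []         _     = refl
raise-single a (od c ∷ U) _     = refl
raise-single a (ev c ∷ U) apart with close? a c
... | yes close = ⊥-elim (apart close)
... | no _      = refl

headApart-++⁻ : ∀ a U R → HeadApart a (U ++ R) → HeadApart a U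
headApart-++⁻ a []         R _     = tt
headApart-++⁻ a (ev c ∷ U) R apart = apart
headApart-++⁻ a (od c ∷ U) R _     = tt

insert-split : ∀ k L → threshold L ≤ k → Σ (List Part) λ U → Σ (List Part) λ R →
  L ≡ U ++ R × AllEven U × threshold U ≤ k × insert k L ≡ raise U ++ od (k ∸ threshold U) ∷ R
insert-split k L t with shape L
... | nil = [] , [] , refl , tt , z≤n , refl
... | odd a r = [] , od a ∷ r , refl , tt , z≤n , refl
... | pair a b r close with k ≤? b
...   | no _ = [] , ev a ∷ ev b ∷ r , refl , tt , z≤n , refl
insert-split (suc k) L (s≤s t) | pair a b r close | yes _ with insert-split k r t
... | U , R , refl , even , tU , split = ev a ∷ ev b ∷ U , R , refl , even , threshold≤ , split′
  where
  threshold≤ : threshold (ev a ∷ ev b ∷ U) ≤ suc k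
  threshold≤ rewrite threshold-pair a b U close = s≤s tU
  split′ : ev (suc b) ∷ ev a ∷ insert k (U ++ R) ≡
           raise (ev a ∷ ev b ∷ U) ++ od (suc k ∸ threshold (ev a ∷ ev b ∷ U)) ∷ R
  split′ rewrite raise-pair a b U close | threshold-pair a b U close = cong (λ Z → ev (suc b) ∷ ev a ∷ Z) split
insert-split k L t | single a r apart with k <? a
...   | no _ = [] , ev a ∷ r , refl , tt , z≤n , refl
...   | yes _ with insert-split k r t
... | U , R , refl , even , tU , split = ev a ∷ U , R , refl , even , threshold≤ , split′
  where
  apartU : HeadApart a U
  apartU = headApart-++⁻ a U R apart
  threshold≤ : threshold (ev a ∷ U) ≤ k
  threshold≤ rewrite threshold-single a U apartU = tU
  split′ : ev a ∷ insert k (U ++ R) ≡ raise (ev a ∷ U) ++ od (k ∸ threshold (ev a ∷ U)) ∷ R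
  split′ rewrite raise-single a U apartU | threshold-single a U apartU = cong (ev a ∷_) split

mutual
  markTwo-raised-pair : ∀ a b U → Close a b → Valid (ev a ∷ ev b ∷ U) → AllEven U →
    markOne (ev (suc b) ∷ ev a ∷ raise U) ≡ false
  markTwo-raised-pair a b U close v even
    rewrite dec-true (close? (suc b) a) (close-raise close)
          | markOne-cons-raise a U (valid-tail (ev b) U (valid-tail (ev a) (ev b ∷ U) v)) even (headRoom-pair a b U v)
    = refl

  markOne-cons-raise : ∀ c W → Valid W → AllEven W → EvenHeadRoom (just c) W → markOne (ev c ∷ raise W) ≡ true
  markOne-cons-raise c W v even room with shape W
  ... | nil              = refl
  ... | odd _ _          = ⊥-elim even
  ... | pair s t W′ close =
    trans (cong (λ m → not (does (close? c (suc t)) ∧ m)) (markTwo-raised-pair s t W′ close v even))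
          (cong not (∧-zeroʳ _))
  ... | single s W′ _ rewrite dec-false (close? c s) (2+≤⇒¬close room) = refl

lower-markOne : ∀ a Y → markOne (ev a ∷ Y) ≡ true → lower (ev a ∷ Y) ≡ ev a ∷ lower Y
lower-markOne a []         _ = refl
lower-markOne a (od d ∷ Y) _ = refl
lower-markOne a (ev d ∷ Y) with does (close? a d) ∧ markOne (ev d ∷ Y)
... | false = λ _ → refl
... | true  = λ ()

lower-markTwo : ∀ a b Y → markOne (ev a ∷ ev b ∷ Y) ≡ false →
  lower (ev a ∷ ev b ∷ Y) ≡ ev b ∷ ev (pred a) ∷ lower Y
lower-markTwo a b Y with does (close? a b) ∧ markOne (ev b ∷ Y)
... | true  = λ _ → refl
... | false = λ ()

lower-raise : ∀ U → Valid U → AllEven U → lower (raise U) ≡ U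
lower-raise U v even with shape U
... | nil     = refl
... | odd _ _ = ⊥-elim even
... | pair a b U′ close = begin
  lower (ev (suc b) ∷ ev a ∷ raise U′)
    ≡⟨ lower-markTwo (suc b) a (raise U′) (markTwo-raised-pair a b U′ close v even) ⟩
  ev a ∷ ev b ∷ lower (raise U′)       ≡⟨ cong (λ Z → ev a ∷ ev b ∷ Z) (lower-raise U′ v′ even) ⟩
  ev a ∷ ev b ∷ U′                     ∎
  where
  v′ : Valid U′
  v′ = valid-tail (ev b) U′ (valid-tail (ev a) (ev b ∷ U′) v)
... | single a U′ apart = begin
  lower (ev a ∷ raise U′)
    ≡⟨ lower-markOne a (raise U′) (markOne-cons-raise a U′ v′ even (headRoom-single a U′ apart v)) ⟩
  ev a ∷ lower (raise U′) ≡⟨ cong (ev a ∷_) (lower-raise U′ v′ even) ⟩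
  ev a ∷ U′               ∎
  where
  v′ : Valid U′
  v′ = valid-tail (ev a) U′ v

allEven-raise : ∀ U → AllEven U → AllEven (raise U)
allEven-raise U even with shape U
... | nil            = tt
... | odd _ _        = ⊥-elim even
... | pair _ _ U′ _  = allEven-raise U′ even
... | single _ U′ _  = allEven-raise U′ even

allEven-++-odd-injective : ∀ E₁ E₂ {x₁ x₂ R₁ R₂} → AllEven E₁ → AllEven E₂ →
  E₁ ++ od x₁ ∷ R₁ ≡ E₂ ++ od x₂ ∷ R₂ → E₁ ≡ E₂ × x₁ ≡ x₂ × R₁ ≡ R₂
allEven-++-odd-injective []          []          _  _  refl = refl , refl , refl
allEven-++-odd-injective (ev a ∷ E₁) (ev b ∷ E₂) e₁ e₂ eq with ∷-injective eq
... | refl , eq′ with allEven-++-odd-injective E₁ E₂ e₁ e₂ eq′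
... | refl , refl , refl = refl , refl , refl
allEven-++-odd-injective []          (ev _ ∷ _)  _  _  ()
allEven-++-odd-injective (ev _ ∷ _)  []          _  _  ()

validUnder-++⁻ˡ : ∀ c₂ c₁ U R → ValidUnder c₂ c₁ (U ++ R) → ValidUnder c₂ c₁ U
validUnder-++⁻ˡ c₂ c₁ []      R v             = tt
validUnder-++⁻ˡ c₂ c₁ (x ∷ U) R (a , g , p , v) = a , g , p , validUnder-++⁻ˡ c₁ (just x) U R v

insert-injective : ∀ k₁ k₂ L₁ L₂ → Valid L₁ → Valid L₂ → threshold L₁ ≤ k₁ → threshold L₂ ≤ k₂ →
  insert k₁ L₁ ≡ insert k₂ L₂ → k₁ ≡ k₂ × L₁ ≡ L₂
insert-injective k₁ k₂ L₁ L₂ v₁ v₂ t₁ t₂ eq with insert-split k₁ L₁ t₁ | insert-split k₂ L₂ t₂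
... | U₁ , R₁ , refl , even₁ , tU₁ , split₁ | U₂ , R₂ , refl , even₂ , tU₂ , split₂
  with allEven-++-odd-injective (raise U₁) (raise U₂) (allEven-raise U₁ even₁) (allEven-raise U₂ even₂)
         (trans (sym split₁) (trans eq split₂))
... | raised , x₁≡x₂ , refl = k₁≡k₂ , cong (_++ R₁) U₁≡U₂
  where
  U₁≡U₂ : U₁ ≡ U₂
  U₁≡U₂ = begin
    U₁               ≡⟨ lower-raise U₁ (validUnder-++⁻ˡ nothing nothing U₁ R₁ v₁) even₁ ⟨
    lower (raise U₁) ≡⟨ cong lower raised ⟩
    lower (raise U₂) ≡⟨ lower-raise U₂ (validUnder-++⁻ˡ nothing nothing U₂ R₁ v₂) even₂ ⟩
    U₂               ∎
  k₁≡k₂ : k₁ ≡ k₂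
  k₁≡k₂ = begin
    k₁                                ≡⟨ m∸n+n≡m tU₁ ⟨
    k₁ ∸ threshold U₁ + threshold U₁  ≡⟨ cong₂ _+_ x₁≡x₂ (cong threshold U₁≡U₂) ⟩
    k₂ ∸ threshold U₂ + threshold U₂  ≡⟨ m∸n+n≡m tU₂ ⟩
    k₂                                ∎

-- Removing the largest odd part

data Lowering (c : ℕ) (r : List Part) : Set where
  markedOne : markOne (ev c ∷ r) ≡ true → lower (ev c ∷ r) ≡ ev c ∷ lower r → Lowering c r
  markedTwo : ∀ {d r′} → r ≡ ev d ∷ r′ → Close c d → markOne (ev d ∷ r′) ≡ true →
              lower (ev c ∷ r) ≡ ev d ∷ ev (pred c) ∷ lower r′ → Lowering c r

lowering : ∀ c r → Lowering c r
lowering c []         = markedOne refl refl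
lowering c (od d ∷ r) = markedOne refl refl
lowering c (ev d ∷ r) with markOne (ev c ∷ ev d ∷ r) in m
... | true  = markedOne m (lower-markOne c (ev d ∷ r) m)
... | false = markedTwo refl (close-sound (∧-conicalˡ _ _ taken)) (∧-conicalʳ _ _ taken) (lower-markTwo c d r m)
  where
  taken : does (close? c d) ∧ markOne (ev d ∷ r) ≡ true
  taken = not-injective m
  close-sound : does (close? c d) ≡ true → Close c d
  close-sound with close? c d
  ... | yes close = λ _ → close
  ... | no _      = λ ()

markOne⇒apart : ∀ c d r → markOne (ev c ∷ ev d ∷ r) ≡ true → markOne (ev d ∷ r) ≡ true → ¬ Close c d
markOne⇒apart c d r m₁ m₂ close rewrite dec-true (close? c d) close | m₂ with () ← m₁

_≼_ : Part → Part → Set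
ev a ≼ ev b = a ≤ b
ev a ≼ od b = a ≤ b
od a ≼ ev b = a < b
od a ≼ od b = a ≤ b

≼⇒level≤ : ∀ y z → y ≼ z → level y ≤ level z
≼⇒level≤ (ev a) (ev b) h = h
≼⇒level≤ (ev a) (od b) h = h
≼⇒level≤ (od a) (ev b) h = <⇒≤ h
≼⇒level≤ (od a) (od b) h = h

adjacent-≼ : ∀ p y z → y ≼ z → Adjacent p z → Adjacent p y
adjacent-≼ p (ev a) (ev b) h adj = ≤-trans h adj
adjacent-≼ p (ev a) (od b) h adj = ≤-trans h (<⇒≤ adj)
adjacent-≼ p (od a) (ev b) h adj = <-≤-trans h adj
adjacent-≼ p (od a) (od b) h adj = ≤-<-trans h adj

gap-≼ : ∀ p y z → y ≼ z → Gap p z → Gap p y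
gap-≼ (ev q) y z h gap = ≤-trans (s≤s (s≤s (≼⇒level≤ y z h))) gap
gap-≼ (od q) y z h gap = ≤-trans (s≤s (≼⇒level≤ y z h)) gap

adjacent⇒≼ : ∀ x y → Adjacent x y → y ≼ x
adjacent⇒≼ (ev a) (ev c) adj = adj
adjacent⇒≼ (ev a) (od c) adj = adj
adjacent⇒≼ (od a) (ev c) adj = adj
adjacent⇒≼ (od a) (od c) adj = <⇒≤ adj

HeadBelow : List Part → List Part → Set
HeadBelow []      _       = ⊤
HeadBelow (y ∷ _) (z ∷ _) = y ≼ z
HeadBelow (_ ∷ _) []      = ⊥

adjacentHead-below : ∀ p Y Z → HeadBelow Y Z → AdjacentHead p Z → AdjacentHead p Y
adjacentHead-below p []      _       _ _   = tt
adjacentHead-below p (y ∷ Y) (z ∷ Z) h adj = adjacent-≼ p y z h adj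

gapHead-below : ∀ p Y Z → HeadBelow Y Z → GapHead p Z → GapHead p Y
gapHead-below p []      _       _ _   = tt
gapHead-below p (y ∷ Y) (z ∷ Z) h gap = gap-≼ p y z h gap

lower-headBelow : ∀ V x L → AllEven V → Valid (V ++ od x ∷ L) → HeadBelow (lower V ++ L) (V ++ od x ∷ L)
lower-headBelow []         x []      _    _ = tt
lower-headBelow []         x (y ∷ L) _    v = adjacent⇒≼ (od x) y (valid-adjacent (od x) y L v)
lower-headBelow (ev c ∷ V) x L       even v with lowering c V
... | markedOne _ eq rewrite eq = ≤-refl
... | markedTwo refl _ _ eq rewrite eq = valid-adjacent (ev c) (ev _) _ v

gapSecond-lower : ∀ a V x L → AllEven V → Valid (ev a ∷ V ++ od x ∷ L) → GapSecond (ev a) (lower V ++ L)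
gapSecond-lower a []         x []          _    _ = tt
gapSecond-lower a []         x (y ∷ [])    _    _ = tt
gapSecond-lower a []         x (y ∷ z ∷ L) _    v =
  ≤-trans (s≤s (valid-gap (od x) y z L (valid-tail (ev a) _ v))) (valid-adjacent (ev a) (od x) _ v)
gapSecond-lower a (ev b ∷ V) x L       even v with lowering b V
... | markedOne _ eq rewrite eq =
  gapHead-below (ev a) (lower V ++ L) (V ++ od x ∷ L)
    (lower-headBelow V x L even (valid-tail (ev b) _ (valid-tail (ev a) _ v))) (valid-gapSecond (ev a) _ v)
... | markedTwo refl close _ eq rewrite eq =
  ≤-trans (s≤s (s≤s (pred-mono-≤ (close⇒≤suc close)))) (valid-gap (ev a) (ev b) (ev _) _ v)

gapHead-lower : ∀ b r x L → AllEven r → Valid (ev b ∷ r ++ od x ∷ L) → markOne (ev b ∷ r) ≡ true →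
  GapHead (ev b) (lower r ++ L)
gapHead-lower b []         x []      _    _ _ = tt
gapHead-lower b []         x (y ∷ L) _    v _ = valid-gap (ev b) (od x) y L v
gapHead-lower b (ev c ∷ r) x L       even v m with lowering c r
... | markedOne m′ eq rewrite eq = ≤∧¬close⇒2+≤ (valid-adjacent (ev b) (ev c) _ v) (markOne⇒apart b c r m m′)
... | markedTwo refl _ _ eq rewrite eq = valid-gap (ev b) (ev c) (ev _) _ v

gapHead-mono : ∀ {c a} Y → c ≤ a → GapHead (ev c) Y → GapHead (ev a) Y
gapHead-mono []      _   _   = tt
gapHead-mono (y ∷ Y) c≤a gap = ≤-trans gap c≤a

gapSecond-pred-lower : ∀ a r x L → AllEven r → Valid (r ++ od x ∷ L) → GapHead (ev a) (r ++ od x ∷ L) →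
  GapSecond (ev (pred a)) (lower r ++ L)
gapSecond-pred-lower a []         x []          _    _ _   = tt
gapSecond-pred-lower a []         x (y ∷ [])    _    _ _   = tt
gapSecond-pred-lower a []         x (y ∷ z ∷ L) _    v gap =
  pred-mono-≤ (≤-trans (s≤s (s≤s (valid-gap (od x) y z L v))) gap)
gapSecond-pred-lower a (ev c ∷ r) x L       even v gap with lowering c r
... | markedOne m eq rewrite eq =
  gapHead-mono (lower r ++ L) (pred-mono-≤ (≤-trans (n≤1+n _) gap)) (gapHead-lower c r x L even v m)
... | markedTwo refl _ _ eq rewrite eq = 2+pred≤pred (valid-positive (ev c) _ v) gap
  where
  2+pred≤pred : ∀ {c a} → 1 ≤ c → 2 + c ≤ a → 2 + pred c ≤ pred a
  2+pred≤pred {suc c} _ h = pred-mono-≤ h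

gap⇒adjacent-pred : ∀ a z → Gap (ev a) z → Adjacent (ev (pred a)) z
gap⇒adjacent-pred a (ev c) gap = pred-mono-≤ (≤-trans (n≤1+n _) gap)
gap⇒adjacent-pred a (od c) gap = pred-mono-≤ gap

lower-valid : ∀ V x L → AllEven V → Valid (V ++ od x ∷ L) → Valid (lower V ++ L)
lower-valid []         x L _    v = valid-tail (od x) L v
lower-valid (ev a ∷ V) x L even v with lowering a V
... | markedOne _ eq rewrite eq =
  valid-cons (ev a) (lower V ++ L) (lower-valid V x L even vV) (valid-positive (ev a) _ v)
    (adjacentHead-below (ev a) (lower V ++ L) (V ++ od x ∷ L) (lower-headBelow V x L even vV) (valid-adjacentHead (ev a) _ v))
    (gapSecond-lower a V x L even v)
  where
  vV : Valid (V ++ od x ∷ L)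
  vV = valid-tail (ev a) _ v
... | markedTwo {b} {r} refl close m eq rewrite eq =
  valid-cons (ev b) (ev (pred a) ∷ lower r ++ L)
    (valid-cons (ev (pred a)) (lower r ++ L) (lower-valid r x L even vr) (pred-mono-≤ (2≤a r gap))
      (adjacentHead-below (ev (pred a)) (lower r ++ L) (r ++ od x ∷ L) (lower-headBelow r x L even vr) (adjacentHead-pred r gap))
      (gapSecond-pred-lower a r x L even vr gap))
    (valid-positive (ev b) _ vb) (pred-mono-≤ (close⇒≤suc close)) (gapHead-lower b r x L even vb m)
  where
  vb : Valid (ev b ∷ r ++ od x ∷ L)
  vb = valid-tail (ev a) _ v
  vr : Valid (r ++ od x ∷ L)
  vr = valid-tail (ev b) _ vb
  gap : GapHead (ev a) (r ++ od x ∷ L)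
  gap = valid-gapSecond (ev a) _ v
  2≤a : ∀ r → GapHead (ev a) (r ++ od x ∷ L) → 2 ≤ a
  2≤a []      gap = ≤-trans (s≤s (s≤s z≤n)) gap
  2≤a (y ∷ r) gap = ≤-trans (s≤s (s≤s z≤n)) gap
  adjacentHead-pred : ∀ r → GapHead (ev a) (r ++ od x ∷ L) → AdjacentHead (ev (pred a)) (r ++ od x ∷ L)
  adjacentHead-pred []      gap = gap⇒adjacent-pred a (od x) gap
  adjacentHead-pred (y ∷ r) gap = gap⇒adjacent-pred a y gap

insert-above : ∀ x L → Valid (od x ∷ L) → insert x L ≡ od x ∷ L
insert-above x L v with shape L
... | nil     = refl
... | odd _ _ = refl
... | pair a b r _ with x ≤? b
...   | no _    = refl
...   | yes x≤b = contradiction (≤-trans (valid-gap (od x) (ev a) (ev b) r v) x≤b) 1+n≰n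
insert-above x L v | single a r _ with x <? a
...   | no _    = refl
...   | yes x<a = contradiction (≤-trans x<a (valid-adjacent (od x) (ev a) r v)) 1+n≰n

insert-single : ∀ k a L → HeadApart a L → k < a → insert k (ev a ∷ L) ≡ ev a ∷ insert k L
insert-single k a L apart k<a with shape (ev a ∷ L)
... | pair .a b r close = contradiction close apart
... | single .a .L _ with k <? a
... | yes _   = refl
... | no k≮a = contradiction k<a k≮a

insert-pair : ∀ k c d Y → Close c d → suc k ≤ d →
  insert (suc k) (ev c ∷ ev d ∷ Y) ≡ ev (suc d) ∷ ev c ∷ insert k Y
insert-pair k c d Y close k<d with close? c d
... | no apart = contradiction close apart
... | yes _ with suc k ≤? d
...   | yes _   = refl
...   | no k≮d = contradiction k<d k≮d

threshold-even-head : ∀ a R → Valid (ev a ∷ R) → threshold (ev a ∷ R) ≤ a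
threshold-even-head a R v with shape (ev a ∷ R)
... | single .a []          _ = z≤n
... | single .a (od c ∷ R′) _ = valid-adjacent (ev a) (od c) R′ v
... | single .a (ev c ∷ R′) _ =
  ≤-trans (threshold-even-head c R′ (valid-tail (ev a) _ v)) (valid-adjacent (ev a) (ev c) R′ v)
... | pair .a b []          _ = valid-positive (ev a) _ v
... | pair .a b (od c ∷ R′) _ = valid-gap (ev a) (ev b) (od c) R′ v
... | pair .a b (ev c ∷ R′) _ =
  ≤-trans (s≤s (threshold-even-head c R′ (valid-tail (ev b) _ (valid-tail (ev a) _ v))))
    (≤-trans (n≤1+n _) (valid-gap (ev a) (ev b) (ev c) R′ v))

threshold-below-odd : ∀ x L → Valid (od x ∷ L) → threshold L ≤ x
threshold-below-odd x []         _ = z≤n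
threshold-below-odd x (od c ∷ L) v = valid-adjacent (od x) (od c) L v
threshold-below-odd x (ev c ∷ L) v =
  ≤-trans (threshold-even-head c L (valid-tail (od x) _ v)) (valid-adjacent (od x) (ev c) L v)

BelowHead : ℕ → List Part → Set
BelowHead k (ev a ∷ _) = k < a
BelowHead k _          = ⊤

record Reinserts (V U : List Part) (x : ℕ) (L : List Part) : Set where
  field
    restores   : insert (x + threshold U) (U ++ L) ≡ V ++ od x ∷ L
    admissible : threshold (U ++ L) ≤ x + threshold U
    below-head : BelowHead (x + threshold U) V

headApart-lower : ∀ a V x L → AllEven V → Valid (ev a ∷ V ++ od x ∷ L) → markOne (ev a ∷ V) ≡ true →
  HeadApart a (lower V ++ L)
headApart-lower a []         x []           _    _ _ = tt
headApart-lower a []         x (od c ∷ L)   _    _ _ = tt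
headApart-lower a []         x (ev c ∷ L)   _    v _ = 2+≤⇒¬close (valid-gap (ev a) (od x) (ev c) L v)
headApart-lower a (ev b ∷ V) x L            even v m with lowering b V
... | markedOne m′ eq rewrite eq = markOne⇒apart a b V m m′
... | markedTwo refl _ _ eq rewrite eq = 2+≤⇒¬close (valid-gap (ev a) (ev b) (ev _) _ v)

reinserts-markedOne : ∀ a V x L → AllEven V → Valid (ev a ∷ V ++ od x ∷ L) → markOne (ev a ∷ V) ≡ true →
  Reinserts V (lower V) x L → Reinserts (ev a ∷ V) (ev a ∷ lower V) x L
reinserts-markedOne a V x L even v m IH = record
  { restores   = restores
  ; admissible = admissible
  ; below-head = below-head
  }
  where
  open Reinserts IH renaming (restores to restores′; admissible to admissible′; below-head to below-head′)
  U : List Part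
  U = lower V
  t : ℕ
  t = threshold U
  apart : HeadApart a (U ++ L)
  apart = headApart-lower a V x L even v m
  apartU : HeadApart a U
  apartU = headApart-++⁻ a U L apart
  k<a : ∀ V → AllEven V → Valid (ev a ∷ V ++ od x ∷ L) → BelowHead (x + threshold (lower V)) V →
        x + threshold (lower V) < a
  k<a []         _ v _   = subst (_< a) (sym (+-identityʳ x)) (valid-adjacent (ev a) (od x) L v)
  k<a (ev b ∷ V) _ v k<b = <-≤-trans k<b (valid-adjacent (ev a) (ev b) _ v)
  restores : insert (x + threshold (ev a ∷ U)) (ev a ∷ U ++ L) ≡ ev a ∷ V ++ od x ∷ L
  restores rewrite threshold-single a U apartU =
    trans (insert-single (x + t) a (U ++ L) apart (k<a V even v below-head′)) (cong (ev a ∷_) restores′)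
  admissible : threshold (ev a ∷ U ++ L) ≤ x + threshold (ev a ∷ U)
  admissible rewrite threshold-single a (U ++ L) apart | threshold-single a U apartU = admissible′
  below-head : x + threshold (ev a ∷ U) < a
  below-head rewrite threshold-single a U apartU = k<a V even v below-head′

reinserts-markedTwo : ∀ a b r x L → AllEven r → Close a b → Valid (ev a ∷ ev b ∷ r ++ od x ∷ L) →
  Reinserts r (lower r) x L → Reinserts (ev a ∷ ev b ∷ r) (ev b ∷ ev (pred a) ∷ lower r) x L
reinserts-markedTwo zero    b r x L _    close v _ with () ← valid-positive (ev zero) _ v
reinserts-markedTwo (suc a) b r x L even close v IH = record
  { restores   = restores
  ; admissible = admissible
  ; below-head = below-head
  }
  where
  open Reinserts IH renaming (restores to restores′; admissible to admissible′; below-head to below-head′)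
  U : List Part
  U = lower r
  t : ℕ
  t = threshold U
  close′ : Close b a
  close′ = close-lower close
  k+1≤a : ∀ r → AllEven r → Valid (ev (suc a) ∷ ev b ∷ r ++ od x ∷ L) → BelowHead (x + threshold (lower r)) r →
        suc (x + threshold (lower r)) ≤ a
  k+1≤a []         _ v _   =
    subst (λ n → suc n ≤ a) (sym (+-identityʳ x)) (≤-pred (valid-gap (ev (suc a)) (ev b) (od x) L v))
  k+1≤a (ev c ∷ r) _ v k<c = ≤-trans k<c (≤-pred (≤-trans (n≤1+n _) (valid-gap (ev (suc a)) (ev b) (ev c) _ v)))
  restores : insert (x + threshold (ev b ∷ ev a ∷ U)) (ev b ∷ ev a ∷ U ++ L) ≡ ev (suc a) ∷ ev b ∷ r ++ od x ∷ L
  restores rewrite threshold-pair b a U close′ | +-suc x t =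
    trans (insert-pair (x + t) b a (U ++ L) close′ (k+1≤a r even v below-head′))
          (cong (λ Z → ev (suc a) ∷ ev b ∷ Z) restores′)
  admissible : threshold (ev b ∷ ev a ∷ U ++ L) ≤ x + threshold (ev b ∷ ev a ∷ U)
  admissible rewrite threshold-pair b a (U ++ L) close′ | threshold-pair b a U close′ | +-suc x t = s≤s admissible′
  below-head : x + threshold (ev b ∷ ev a ∷ U) < suc a
  below-head rewrite threshold-pair b a U close′ | +-suc x t = s≤s (k+1≤a r even v below-head′)

insert-lower : ∀ V x L → AllEven V → Valid (V ++ od x ∷ L) → Reinserts V (lower V) x L
insert-lower [] x L _ v = record { restores = restores ; admissible = admissible ; below-head = tt }
  where
  restores : insert (x + 0) L ≡ od x ∷ L
  restores rewrite +-identityʳ x = insert-above x L v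
  admissible : threshold L ≤ x + 0
  admissible rewrite +-identityʳ x = threshold-below-odd x L v
insert-lower (ev a ∷ V) x L even v with lowering a V
... | markedOne m eq rewrite eq =
  reinserts-markedOne a V x L even v m (insert-lower V x L even (valid-tail (ev a) _ v))
... | markedTwo {b} {r} refl close _ eq rewrite eq =
  reinserts-markedTwo a b r x L even close v (insert-lower r x L even (valid-tail (ev b) _ (valid-tail (ev a) _ v)))

-- Inserting all odd parts

insertAll : List Part → List ℕ → List Part
insertAll P []       = P
insertAll P (k ∷ ks) = insert k (insertAll P ks)

minNext : ℕ → List ℕ → ℕ
minNext N []      = N
minNext N (k ∷ _) = suc k

Admissible : ℕ → List ℕ → Set
Admissible N []       = ⊤
Admissible N (k ∷ ks) = Admissible N ks × minNext N ks ≤ k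

insertAll-valid : ∀ P ks → Valid P → Admissible (threshold P) ks →
  Valid (insertAll P ks) × threshold (insertAll P ks) ≡ minNext (threshold P) ks
insertAll-valid P []       v _ = v , refl
insertAll-valid P (k ∷ ks) v (adm , next≤k) with insertAll-valid P ks v adm
... | v′ , t≡next = insert-valid k (insertAll P ks) nothing nothing v′ t≤k tt tt tt tt tt ,
                    threshold-insert k (insertAll P ks) v′ t≤k
  where
  t≤k : threshold (insertAll P ks) ≤ k
  t≤k = subst (_≤ k) (sym t≡next) next≤k

total-insertAll : ∀ P ks → Valid P → Admissible (threshold P) ks →
  total (insertAll P ks) ≡ total P + total (map od ks)
total-insertAll P []       _ _            = sym (+-identityʳ (total P))
total-insertAll P (k ∷ ks) v (adm , next) = begin
  total (insert k (insertAll P ks))              ≡⟨ total-insert k (insertAll P ks) t≤k ⟩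
  total (insertAll P ks) + value (od k)          ≡⟨ cong (_+ value (od k)) (total-insertAll P ks v adm) ⟩
  total P + total (map od ks) + value (od k)     ≡⟨ +-assoc (total P) _ _ ⟩
  total P + (total (map od ks) + value (od k))   ≡⟨ cong (total P +_) (+-comm (total (map od ks)) _) ⟩
  total P + (value (od k) + total (map od ks))   ∎
  where
  t≤k : threshold (insertAll P ks) ≤ k
  t≤k = subst (_≤ k) (sym (proj₂ (insertAll-valid P ks v adm))) next

length-insertAll : ∀ P ks → length (insertAll P ks) ≡ length P + length ks
length-insertAll P []       = sym (+-identityʳ (length P))
length-insertAll P (k ∷ ks) = begin
  length (insert k (insertAll P ks)) ≡⟨ length-insert k (insertAll P ks) ⟩
  suc (length (insertAll P ks))      ≡⟨ cong suc (length-insertAll P ks) ⟩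
  suc (length P + length ks)         ≡⟨ +-suc (length P) (length ks) ⟨
  length P + suc (length ks)         ∎

insert-¬allEven : ∀ k L → ¬ AllEven (insert k L)
insert-¬allEven k L with shape L
... | nil     = λ ()
... | odd _ _ = λ ()
... | pair a b r _ with k ≤? b
...   | yes _ = insert-¬allEven (pred k) r
...   | no _  = λ ()
insert-¬allEven k L | single a r _ with k <? a
...   | yes _ = insert-¬allEven k r
...   | no _  = λ ()

insertAll-injective : ∀ P₁ P₂ ks₁ ks₂ → Valid P₁ → Valid P₂ → AllEven P₁ → AllEven P₂ →
  Admissible (threshold P₁) ks₁ → Admissible (threshold P₂) ks₂ →
  insertAll P₁ ks₁ ≡ insertAll P₂ ks₂ → P₁ ≡ P₂ × ks₁ ≡ ks₂
insertAll-injective P₁ P₂ []        []        _  _  _  _  _ _ eq = eq , refl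
insertAll-injective P₁ P₂ []        (k ∷ ks₂) _  _  e₁ _  _ _ eq =
  contradiction (subst AllEven eq e₁) (insert-¬allEven k (insertAll P₂ ks₂))
insertAll-injective P₁ P₂ (k ∷ ks₁) []        _  _  _  e₂ _ _ eq =
  contradiction (subst AllEven (sym eq) e₂) (insert-¬allEven k (insertAll P₁ ks₁))
insertAll-injective P₁ P₂ (k₁ ∷ ks₁) (k₂ ∷ ks₂) v₁ v₂ e₁ e₂ (adm₁ , n₁≤k₁) (adm₂ , n₂≤k₂) eq
  with insertAll-valid P₁ ks₁ v₁ adm₁ | insertAll-valid P₂ ks₂ v₂ adm₂
... | w₁ , t₁ | w₂ , t₂
  with insert-injective k₁ k₂ (insertAll P₁ ks₁) (insertAll P₂ ks₂) w₁ w₂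
         (subst (_≤ k₁) (sym t₁) n₁≤k₁) (subst (_≤ k₂) (sym t₂) n₂≤k₂) eq
... | refl , eq′ with insertAll-injective P₁ P₂ ks₁ ks₂ v₁ v₂ e₁ e₂ adm₁ adm₂ eq′
... | refl , refl = refl , refl

data FirstOdd : List Part → Set where
  none  : ∀ L → AllEven L → FirstOdd L
  split : ∀ V x L → AllEven V → FirstOdd (V ++ od x ∷ L)

firstOdd : ∀ L → FirstOdd L
firstOdd []         = none [] tt
firstOdd (od x ∷ L) = split [] x L tt
firstOdd (ev a ∷ L) with firstOdd L
... | none .L even     = none (ev a ∷ L) even
... | split V x R even = split (ev a ∷ V) x R even

length-lower : ∀ V → length (lower V) ≡ length V
length-lower []         = refl
length-lower (od x ∷ V) = cong suc (length-lower V)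
length-lower (ev a ∷ V) with lowering a V
... | markedOne _ eq rewrite eq = cong suc (length-lower V)
... | markedTwo {r′ = r} refl _ _ eq rewrite eq = cong (λ n → suc (suc n)) (length-lower r)

insertAll-surjective : ∀ n Ω → length Ω ≤ n → Valid Ω →
  Σ (List Part) λ P → Σ (List ℕ) λ ks → Valid P × AllEven P × Admissible (threshold P) ks × insertAll P ks ≡ Ω
insertAll-surjective n Ω _ v with firstOdd Ω
... | none .Ω even = Ω , [] , v , even , tt , refl
insertAll-surjective zero .(V ++ od x ∷ L) len≤0 v | split V x L even
  with () ← subst (_≤ 0) (trans (length-++ V) (+-suc (length V) (length L))) len≤0
insertAll-surjective (suc n) .(V ++ od x ∷ L) len≤n v | split V x L even
  with insertAll-surjective n (lower V ++ L) shorter (lower-valid V x L even v)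
  where
  shorter : length (lower V ++ L) ≤ n
  shorter = ≤-pred (subst (_≤ suc n) (sym length-removed) len≤n)
    where
    length-removed : suc (length (lower V ++ L)) ≡ length (V ++ od x ∷ L)
    length-removed = begin
      suc (length (lower V ++ L))      ≡⟨ cong suc (length-++ (lower V)) ⟩
      suc (length (lower V) + length L) ≡⟨ cong (λ n → suc (n + length L)) (length-lower V) ⟩
      suc (length V + length L)        ≡⟨ +-suc (length V) (length L) ⟨
      length V + suc (length L)        ≡⟨ length-++ V ⟨
      length (V ++ od x ∷ L)           ∎
... | P , ks , vP , eP , adm , eq = P , k ∷ ks , vP , eP , (adm , next≤k) , trans (cong (insert k) eq) restores
  where
  open Reinserts (insert-lower V x L even v)
  k : ℕ
  k = x + threshold (lower V)
  next≤k : minNext (threshold P) ks ≤ k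
  next≤k = subst (_≤ k) (trans (cong threshold (sym eq)) (proj₂ (insertAll-valid P ks vP adm))) admissible

T-∧⁻ : ∀ {x y} → T (x ∧ y) → T x × T y
T-∧⁻ {x} {y} = Equivalence.to (T-∧ {x} {y})

T-∧⁺ : ∀ {x y} → T x → T y → T (x ∧ y)
T-∧⁺ {x} {y} p q = Equivalence.from (T-∧ {x} {y}) (p , q)

m+m≤n+n⇒m≤n : ∀ {m n} → m + m ≤ n + n → m ≤ n
m+m≤n+n⇒m≤n {zero}              _ = z≤n
m+m≤n+n⇒m≤n {suc m} {suc n} h rewrite +-suc m m | +-suc n n = s≤s (m+m≤n+n⇒m≤n (≤-pred (≤-pred h)))

1+m+m≤n+n⇒m<n : ∀ {m n} → suc (m + m) ≤ n + n → m < n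
1+m+m≤n+n⇒m<n {zero}  {suc n} _ = s≤s z≤n
1+m+m≤n+n⇒m<n {suc m} {suc n} h rewrite +-suc m m | +-suc n n = s≤s (1+m+m≤n+n⇒m<n (≤-pred (≤-pred h)))

m+m≤1+n+n⇒m≤n : ∀ {m n} → m + m ≤ suc (n + n) → m ≤ n
m+m≤1+n+n⇒m≤n {zero}                  _         = z≤n
m+m≤1+n+n⇒m≤n {suc zero}    {zero}    (s≤s ())
m+m≤1+n+n⇒m≤n {suc (suc m)} {zero}    (s≤s ())
m+m≤1+n+n⇒m≤n {suc m}       {suc n} h rewrite +-suc m m | +-suc n n = s≤s (m+m≤1+n+n⇒m≤n (≤-pred (≤-pred h)))

m≤n⇒m+m≤n+n : ∀ {m n} → m ≤ n → m + m ≤ n + n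
m≤n⇒m+m≤n+n h = +-mono-≤ h h

isEven-value-ev : ∀ a → isEven (value (ev a)) ≡ true
isEven-value-ev zero                          = refl
isEven-value-ev (suc a) rewrite +-suc a a = isEven-value-ev a

isEven-value-od : ∀ a → isEven (value (od a)) ≡ false
isEven-value-od zero                          = refl
isEven-value-od (suc a) rewrite +-suc a a = isEven-value-od a

isOdd-value-ev : ∀ a → isOdd (value (ev a)) ≡ false
isOdd-value-ev a rewrite isEven-value-ev a = refl

isOdd-value-od : ∀ a → isOdd (value (od a)) ≡ true
isOdd-value-od a rewrite isEven-value-od a = refl

bump : Part → Part
bump (ev a) = ev (suc a)
bump (od a) = od (suc a)

toPart : ℕ → Part
toPart zero          = ev zero
toPart (suc zero)    = od zero
toPart (suc (suc n)) = bump (toPart n)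

value-bump : ∀ p → value (bump p) ≡ 2 + value p
value-bump (ev a) = cong suc (+-suc a a)
value-bump (od a) = cong (λ n → suc (suc n)) (+-suc a a)

level-bump : ∀ p → level (bump p) ≡ suc (level p)
level-bump (ev c) = refl
level-bump (od c) = refl

value-toPart : ∀ n → value (toPart n) ≡ n
value-toPart zero          = refl
value-toPart (suc zero)    = refl
value-toPart (suc (suc n)) = trans (value-bump (toPart n)) (cong (λ m → suc (suc m)) (value-toPart n))

toPart-value : ∀ p → toPart (value p) ≡ p
toPart-value (ev a) = toPart-even a
  where
  toPart-even : ∀ a → toPart (a + a) ≡ ev a
  toPart-even zero                          = refl
  toPart-even (suc a) rewrite +-suc a a = cong bump (toPart-even a)
toPart-value (od a) = toPart-odd a
  where
  toPart-odd : ∀ a → toPart (suc (a + a)) ≡ od a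
  toPart-odd zero                          = refl
  toPart-odd (suc a) rewrite +-suc a a = cong bump (toPart-odd a)

map-value-toPart : ∀ ω → map value (map toPart ω) ≡ ω
map-value-toPart []      = refl
map-value-toPart (n ∷ ω) = cong₂ _∷_ (value-toPart n) (map-value-toPart ω)

map-toPart-value : ∀ L → map toPart (map value L) ≡ L
map-toPart-value []      = refl
map-toPart-value (p ∷ L) = cong₂ _∷_ (toPart-value p) (map-toPart-value L)

value-injective : ∀ {p q} → value p ≡ value q → p ≡ q
value-injective {p} {q} eq = trans (sym (toPart-value p)) (trans (cong toPart eq) (toPart-value q))

map-value-injective : ∀ {P Q} → map value P ≡ map value Q → P ≡ Q
map-value-injective {P} {Q} eq = trans (sym (map-toPart-value P)) (trans (cong (map toPart) eq) (map-toPart-value Q))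

value<ev⇒level< : ∀ w a → value w < value (ev a) → level w < a
value<ev⇒level< (ev c) a h = 1+m+m≤n+n⇒m<n h
value<ev⇒level< (od c) a h = m+m≤n+n⇒m≤n (subst (_≤ a + a) (sym (cong suc (+-suc c c))) h)

level<⇒value<ev : ∀ w a → level w < a → value w < value (ev a)
level<⇒value<ev (ev c) a h = ≤-trans (n≤1+n _) (subst (_≤ a + a) (cong suc (+-suc c c)) (m≤n⇒m+m≤n+n h))
level<⇒value<ev (od c) a h = subst (_≤ a + a) (cong suc (+-suc c c)) (m≤n⇒m+m≤n+n h)

value≤od⇒level≤ : ∀ w a → value w ≤ value (od a) → level w ≤ a
value≤od⇒level≤ (ev c) a h = m+m≤1+n+n⇒m≤n h
value≤od⇒level≤ (od c) a h = m+m≤n+n⇒m≤n (≤-pred h)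

level≤⇒value≤od : ∀ w a → level w ≤ a → value w ≤ value (od a)
level≤⇒value≤od (ev c) a h = ≤-trans (m≤n⇒m+m≤n+n h) (n≤1+n _)
level≤⇒value≤od (od c) a h = s≤s (m≤n⇒m+m≤n+n h)

≼⇒value≤ : ∀ y z → y ≼ z → value y ≤ value z
≼⇒value≤ (ev a) (ev b) h = m≤n⇒m+m≤n+n h
≼⇒value≤ (ev a) (od b) h = level≤⇒value≤od (ev a) b h
≼⇒value≤ (od a) (ev b) h = <⇒≤ (level<⇒value<ev (od a) b h)
≼⇒value≤ (od a) (od b) h = level≤⇒value≤od (od a) b h

value≤⇒≼ : ∀ y z → value y ≤ value z → y ≼ z
value≤⇒≼ (ev a) (ev b) h = m+m≤n+n⇒m≤n h
value≤⇒≼ (ev a) (od b) h = value≤od⇒level≤ (ev a) b h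
value≤⇒≼ (od a) (ev b) h = 1+m+m≤n+n⇒m<n h
value≤⇒≼ (od a) (od b) h = value≤od⇒level≤ (od a) b h

positive⇒1≤value : ∀ x → Positive x → 1 ≤ value x
positive⇒1≤value (ev (suc a)) _ = s≤s z≤n
positive⇒1≤value (od a)       _ = s≤s z≤n

1≤value⇒positive : ∀ x → 1 ≤ value x → Positive x
1≤value⇒positive (ev (suc a)) _ = s≤s z≤n
1≤value⇒positive (od a)       _ = tt

noRepeatᵇ : ℕ → ℕ → Bool
noRepeatᵇ m n = not ((m ≡ᵇ n) ∧ isOdd m)

adjacent-from-tests : ∀ x y → T (value y ≤ᵇ value x) → T (noRepeatᵇ (value x) (value y)) → Adjacent x y
adjacent-from-tests (ev a) (ev b) le _        = value≤⇒≼ (ev b) (ev a) (≤ᵇ⇒≤ _ _ le)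
adjacent-from-tests (ev a) (od b) le _        = value≤⇒≼ (od b) (ev a) (≤ᵇ⇒≤ _ _ le)
adjacent-from-tests (od a) (ev b) le _        = value≤⇒≼ (ev b) (od a) (≤ᵇ⇒≤ _ _ le)
adjacent-from-tests (od a) (od b) le distinct = ≤∧≢⇒< (value≤⇒≼ (od b) (od a) (≤ᵇ⇒≤ _ _ le)) b≢a
  where
  b≢a : b ≢ a
  b≢a refl = subst T (Equivalence.to T-not-≡ distinct)
    (T-∧⁺ (≡⇒≡ᵇ (value (od a)) _ refl) (subst T (sym (isOdd-value-od a)) tt))

adjacent-tests : ∀ x y → Adjacent x y → T (value y ≤ᵇ value x) × T (noRepeatᵇ (value x) (value y))
adjacent-tests x y adj = ≤⇒≤ᵇ (≼⇒value≤ y x (adjacent⇒≼ x y adj)) , distinct x y adj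
  where
  distinct : ∀ x y → Adjacent x y → T (noRepeatᵇ (value x) (value y))
  distinct x y adj with value x ≡ᵇ value y in eq
  ... | false = tt
  ... | true  = repeated x y adj (value-injective (≡ᵇ⇒≡ (value x) (value y) (subst T (sym eq) tt)))
    where
    repeated : ∀ x y → Adjacent x y → x ≡ y → T (not (true ∧ isOdd (value x)))
    repeated (ev a) .(ev a) _   refl rewrite isOdd-value-ev a = tt
    repeated (od a) .(od a) a<a refl = contradiction a<a (<-irrefl refl)

gapᵇ : ℕ → ℕ → Bool
gapᵇ a c = if isEven a then c + 2 <ᵇ a else c + 2 ≤ᵇ a

value+2 : ∀ z → value z + 2 ≡ value (bump z)
value+2 z = trans (+-comm (value z) 2) (sym (value-bump z))

gapᵇ-ev : ∀ a c → gapᵇ (value (ev a)) c ≡ (c + 2 <ᵇ a + a)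
gapᵇ-ev a c rewrite isEven-value-ev a = refl

gapᵇ-od : ∀ a c → gapᵇ (value (od a)) c ≡ (c + 2 ≤ᵇ suc (a + a))
gapᵇ-od a c rewrite isEven-value-od a = refl

gap-from-test : ∀ x z → T (gapᵇ (value x) (value z)) → Gap x z
gap-from-test (ev a) z h = subst (_< a) (level-bump z)
  (value<ev⇒level< (bump z) a (subst (_< a + a) (value+2 z) (<ᵇ⇒< _ _ (subst T (gapᵇ-ev a (value z)) h))))
gap-from-test (od a) z h = subst (_≤ a) (level-bump z)
  (value≤od⇒level≤ (bump z) a (subst (_≤ suc (a + a)) (value+2 z) (≤ᵇ⇒≤ _ _ (subst T (gapᵇ-od a (value z)) h))))

gap-test : ∀ x z → Gap x z → T (gapᵇ (value x) (value z))
gap-test (ev a) z gap = subst T (sym (gapᵇ-ev a (value z)))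
  (<⇒<ᵇ (subst (_< a + a) (sym (value+2 z)) (level<⇒value<ev (bump z) a (subst (_< a) (sym (level-bump z)) gap))))
gap-test (od a) z gap = subst T (sym (gapᵇ-od a (value z)))
  (≤⇒≤ᵇ (subst (_≤ suc (a + a)) (sym (value+2 z))
    (level≤⇒value≤od (bump z) a (subst (_≤ a) (sym (level-bump z)) gap))))

valid-from-tests : ∀ L → T (isPartition (map value L)) → T (noRepeatedOdd (map value L)) → T (gapCond (map value L)) →
  Valid L
valid-from-tests []          _    _        _    = tt
valid-from-tests (x ∷ [])    pos  _        _    = tt , tt , 1≤value⇒positive x (≤ᵇ⇒≤ 1 (value x) pos) , tt
valid-from-tests (x ∷ y ∷ r) desc distinct gaps =
  extend (valid-from-tests (y ∷ r) (proj₂ (T-∧⁻ {value y ≤ᵇ value x} desc))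
           (proj₂ (T-∧⁻ {noRepeatᵇ (value x) (value y)} distinct)) (gapsTail r gaps))
  where
  y≤x : T (value y ≤ᵇ value x)
  y≤x = proj₁ (T-∧⁻ {value y ≤ᵇ value x} desc)
  x≠y : T (noRepeatᵇ (value x) (value y))
  x≠y = proj₁ (T-∧⁻ {noRepeatᵇ (value x) (value y)} distinct)
  gapsTail : ∀ r → T (gapCond (value x ∷ value y ∷ map value r)) → T (gapCond (value y ∷ map value r))
  gapsTail []      _    = tt
  gapsTail (z ∷ r) gaps = proj₂ (T-∧⁻ {gapᵇ (value x) (value z)} gaps)
  gapHead : ∀ r → T (gapCond (value x ∷ value y ∷ map value r)) → GapHead x r
  gapHead []      _    = tt
  gapHead (z ∷ r) gaps = gap-from-test x z (proj₁ (T-∧⁻ {gapᵇ (value x) (value z)} gaps))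
  extend : Valid (y ∷ r) → Valid (x ∷ y ∷ r)
  extend vyr = valid-cons x (y ∷ r) vyr
    (1≤value⇒positive x (≤-trans (positive⇒1≤value y (valid-positive y r vyr)) (≤ᵇ⇒≤ _ _ y≤x)))
    (adjacent-from-tests x y y≤x x≠y) (gapHead r gaps)

valid-tests : ∀ L → Valid L →
  T (isPartition (map value L)) × T (noRepeatedOdd (map value L)) × T (gapCond (map value L))
valid-tests []          _ = tt , tt , tt
valid-tests (x ∷ [])    v = ≤⇒≤ᵇ (positive⇒1≤value x (valid-positive x [] v)) , tt , tt
valid-tests (x ∷ y ∷ r) v
  with valid-tests (y ∷ r) (valid-tail x (y ∷ r) v) | adjacent-tests x y (valid-adjacent x y r v)
... | desc , distinct , gaps | y≤x , x≠y = T-∧⁺ y≤x desc , T-∧⁺ x≠y distinct , gapsCons r v gaps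
  where
  gapsCons : ∀ r′ → Valid (x ∷ y ∷ r′) → T (gapCond (value y ∷ map value r′)) →
             T (gapCond (value x ∷ value y ∷ map value r′))
  gapsCons []       _ _    = tt
  gapsCons (z ∷ r′) v gaps = T-∧⁺ (gap-test x z (valid-gap x y z r′ v)) gaps

few-small-parts : ∀ x r → Valid (x ∷ r) → value x ≤ 2 → length r ≤ 1
few-small-parts x      []          _ _ = z≤n
few-small-parts x      (y ∷ [])    _ _ = s≤s z≤n
few-small-parts (ev a) (y ∷ z ∷ r) v h =
  contradiction (≤-trans (valid-gap (ev a) y z r v) (m+m≤n+n⇒m≤n {a} {1} h)) λ { (s≤s ()) }
few-small-parts (od a) (y ∷ z ∷ r) v h =
  contradiction (≤-trans (valid-gap (od a) y z r v) (m+m≤1+n+n⇒m≤n {a} {0} (≤-pred h))) λ ()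

smallParts≤2 : ∀ L → Valid L → smallParts (map value L) ≤ 2
smallParts≤2 []      _ = z≤n
smallParts≤2 (x ∷ r) v with value x ≤ᵇ 2 in small
... | true  = s≤s (≤-trans (length-filter (_≤? 2) (map value r))
                (≤-trans (≤-reflexive (length-map value r))
                         (few-small-parts x r v (≤ᵇ⇒≤ (value x) 2 (subst T (sym small) tt)))))
... | false = smallParts≤2 r (valid-tail x r v)

isC33⇒valid : ∀ L → T (isC33 (map value L)) → Valid L
isC33⇒valid L h with T-∧⁻ {isPartition (map value L)} h
... | desc , h′ with T-∧⁻ {noRepeatedOdd (map value L)} h′
... | distinct , h″ = valid-from-tests L desc distinct (proj₁ (T-∧⁻ {gapCond (map value L)} h″))

valid⇒isC33 : ∀ L → Valid L → T (isC33 (map value L))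
valid⇒isC33 L v with valid-tests L v
... | desc , distinct , gaps = T-∧⁺ desc (T-∧⁺ distinct (T-∧⁺ gaps (≤⇒≤ᵇ (smallParts≤2 L v))))

allEven⇒AllEven : ∀ L → T (allEven (map value L)) → AllEven L
allEven⇒AllEven []         _ = tt
allEven⇒AllEven (ev a ∷ L) h = allEven⇒AllEven L (proj₂ (T-∧⁻ {isEven (value (ev a))} h))
allEven⇒AllEven (od a ∷ L) h = subst T (isEven-value-od a) (proj₁ (T-∧⁻ {isEven (value (od a))} h))

AllEven⇒allEven : ∀ L → AllEven L → T (allEven (map value L))
AllEven⇒allEven []         _    = tt
AllEven⇒allEven (ev a ∷ L) even = T-∧⁺ (subst T (sym (isEven-value-ev a)) tt) (AllEven⇒allEven L even)

-- Göllnitz–Gordon marks of even partitions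

markAsc-++ : ∀ done xs ys → markAsc done (xs ++ ys) ≡ markAsc (markAsc done xs) ys
markAsc-++ done []       ys = refl
markAsc-++ done (p ∷ xs) ys = markAsc-++ _ xs ys

GG-cons : ∀ x xs → GG (x ∷ xs) ≡ (x , mex₁ (forbiddenMarks x (GG xs))) ∷ GG xs
GG-cons x xs = trans (cong (markAsc []) (unfold-reverse x xs)) (markAsc-++ [] (reverse xs) (x ∷ []))

map-proj₁-GG : ∀ xs → map proj₁ (GG xs) ≡ xs
map-proj₁-GG []       = refl
map-proj₁-GG (x ∷ xs) = trans (cong (map proj₁) (GG-cons x xs)) (cong (x ∷_) (map-proj₁-GG xs))

forbiddenMarks-none : ∀ p done → All (λ q → conflicts p q ≡ false) (map proj₁ done) → forbiddenMarks p done ≡ []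
forbiddenMarks-none p []               []               = refl
forbiddenMarks-none p ((q , m) ∷ done) (free ∷ frees) rewrite free = forbiddenMarks-none p done frees

conflicts-far : ∀ a c → 2 + c ≤ a → conflicts (value (ev a)) (value (ev c)) ≡ false
conflicts-far a c h = far (m≤n⇒∃[o]m+o≡n h)
  where
  double : ∀ c d → (2 + c + d) + (2 + c + d) ≡ (c + c) + (4 + (d + d))
  double = solve-∀
  far : (Σ ℕ λ d → 2 + c + d ≡ a) → conflicts (value (ev a)) (value (ev c)) ≡ false
  far (d , refl) rewrite isOdd-value-ev (2 + c + d) | double c d | m+n∸m≡n (c + c) (4 + (d + d)) = refl

conflicts-close : ∀ a b → Close a b → conflicts (value (ev a)) (value (ev b)) ≡ true
conflicts-close a .a        (inj₁ refl) rewrite isOdd-value-ev a | n∸n≡0 (a + a) = refl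
conflicts-close .(suc b) b (inj₂ refl) rewrite isOdd-value-ev (suc b) | +-suc b b = 2+n∸n≤2 (b + b)
  where
  2+n∸n≤2 : ∀ n → (2 + n ∸ n ≤ᵇ 2) ≡ true
  2+n∸n≤2 zero    = refl
  2+n∸n≤2 (suc n) = 2+n∸n≤2 n

conflicts-none-below : ∀ a r → AllEven r → Valid r → EvenHeadRoom (just a) r →
  All (λ q → conflicts (value (ev a)) q ≡ false) (map value r)
conflicts-none-below a []         _    _ _    = []
conflicts-none-below a (ev c ∷ r) even v room =
  conflicts-far a c room ∷ conflicts-none-below a r even (valid-tail (ev c) r v) (roomBelow r v)
  where
  roomBelow : ∀ r → Valid (ev c ∷ r) → EvenHeadRoom (just a) r
  roomBelow []         _ = tt
  roomBelow (od d ∷ r) _ = tt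
  roomBelow (ev d ∷ r) v = ≤-trans (s≤s (s≤s (valid-adjacent (ev c) (ev d) r v))) room

forbiddenMarks-room : ∀ a r → AllEven r → Valid r → EvenHeadRoom (just a) r →
  forbiddenMarks (value (ev a)) (GG (map value r)) ≡ []
forbiddenMarks-room a r even v room = forbiddenMarks-none (value (ev a)) (GG (map value r))
  (subst (All _) (sym (map-proj₁-GG (map value r))) (conflicts-none-below a r even v room))

mark-ev : ∀ a r → AllEven r → Valid (ev a ∷ r) →
  mex₁ (forbiddenMarks (value (ev a)) (GG (map value r))) ≡ (if markOne (ev a ∷ r) then 1 else 2)
mark-ev a []         _    _ = refl
mark-ev a (ev b ∷ r) even v rewrite GG-cons (value (ev b)) (map value r)
                                  | forbiddenMarks-room a r even (valid-tail (ev b) r (valid-tail (ev a) _ v)) (headRoom-pair a b r v)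
                                  | mark-ev b r even (valid-tail (ev a) _ v)
  with close? a b
... | yes close rewrite conflicts-close a b close with markOne (ev b ∷ r)
...   | true  = refl
...   | false = refl
mark-ev a (ev b ∷ r) even v | no apart
  rewrite conflicts-far a b (≤∧¬close⇒2+≤ (valid-adjacent (ev a) (ev b) r v) apart) = refl

N₂-cons : ∀ a r → AllEven r → Valid (ev a ∷ r) →
  N₂ (value (ev a) ∷ map value r) ≡ (if markOne (ev a ∷ r) then 0 else 1) + N₂ (map value r)
N₂-cons a r even v rewrite GG-cons (value (ev a)) (map value r) | mark-ev a r even v with markOne (ev a ∷ r)
... | true  = refl
... | false = refl

markOne-apart : ∀ a r → HeadApart a r → markOne (ev a ∷ r) ≡ true
markOne-apart a []         _     = refl
markOne-apart a (od b ∷ r) _     = refl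
markOne-apart a (ev b ∷ r) apart rewrite dec-false (close? a b) apart = refl

N₂-threshold : ∀ P → AllEven P → Valid P → N₂ (map value P) ≡ threshold P
N₂-threshold P even v with shape P
... | nil     = refl
... | odd _ _ = ⊥-elim even
... | pair a b r close = pairCase (N₂-threshold r even vr)
  where
  vbr : Valid (ev b ∷ r)
  vbr = valid-tail (ev a) (ev b ∷ r) v
  vr : Valid r
  vr = valid-tail (ev b) r vbr
  pairCase : N₂ (map value r) ≡ threshold r → N₂ (value (ev a) ∷ value (ev b) ∷ map value r) ≡ suc (threshold r)
  pairCase ih rewrite N₂-cons a (ev b ∷ r) even v | N₂-cons b r even vbr | dec-true (close? a b) close
    with markOne (ev b ∷ r)
  ... | true  = cong suc ih
  ... | false = cong suc ih
N₂-threshold P even v | single a r apart rewrite N₂-cons a r even v | markOne-apart a r apart =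
  N₂-threshold r even (valid-tail (ev a) r v)

2N+1≡value : ∀ N → 2 * N + 1 ≡ suc (N + N)
2N+1≡value = solve-∀

odd-value : ∀ z → T (isOdd z) → Σ ℕ λ k → z ≡ value (od k)
odd-value z z-odd with toPart z in eq
... | od k = k , trans (sym (value-toPart z)) (cong value eq)
... | ev a = ⊥-elim (subst T (trans (cong isOdd (trans (sym (value-toPart z)) (cong value eq))) (isOdd-value-ev a)) z-odd)

admissible-bound : ∀ N ks k → Admissible N ks → minNext N ks ≤ k → N ≤ k
admissible-bound N []        k _            h = h
admissible-bound N (k′ ∷ ks) k (adm , next) h = admissible-bound N ks k adm (≤-trans next (≤-trans (n≤1+n k′) h))

strictlyDecreasing-tail : ∀ z ζ → T (strictlyDecreasing (z ∷ ζ)) → T (strictlyDecreasing ζ)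
strictlyDecreasing-tail z []      _    = tt
strictlyDecreasing-tail z (y ∷ ζ) decr = proj₂ (T-∧⁻ {y <ᵇ z} decr)

isI⇒admissible : ∀ N ζ → T (isI N ζ) → Σ (List ℕ) λ ks → ζ ≡ map value (map od ks) × Admissible N ks
isI⇒admissible N ζ h with T-∧⁻ {isPartition ζ} h
... | _ , rest with T-∧⁻ {strictlyDecreasing ζ} rest
... | decr , large = fromTests ζ decr large
  where
  fromTests : ∀ ζ → T (strictlyDecreasing ζ) → T (allOddAtLeast (2 * N + 1) ζ) →
              Σ (List ℕ) λ ks → ζ ≡ map value (map od ks) × Admissible N ks
  fromTests []      _    _     = [] , refl , tt
  fromTests (z ∷ ζ) decr large with T-∧⁻ {isOdd z} large
  ... | z-odd , large′ with odd-value z z-odd | T-∧⁻ {2 * N + 1 ≤ᵇ z} large′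
  ... | k , refl | N≤z , large″ with fromTests ζ (strictlyDecreasing-tail _ ζ decr) large″
  ... | ks , refl , adm = k ∷ ks , refl , adm , next ks decr
    where
    next : ∀ ks → T (strictlyDecreasing (value (od k) ∷ map value (map od ks))) → minNext N ks ≤ k
    next []        _    = value≤od⇒level≤ (od N) k (subst (_≤ value (od k)) (2N+1≡value N) (≤ᵇ⇒≤ _ _ N≤z))
    next (k′ ∷ ks) decr = 1+m+m≤n+n⇒m<n (≤-pred (<ᵇ⇒< _ _ (proj₁ (T-∧⁻ {value (od k′) <ᵇ value (od k)} decr))))

admissible⇒isI : ∀ N ks → Admissible N ks → T (isI N (map value (map od ks)))
admissible⇒isI N ks adm = T-∧⁺ (descending ks adm) (T-∧⁺ (decreasing ks adm) (large ks adm))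
  where
  descending : ∀ ks → Admissible N ks → T (isPartition (map value (map od ks)))
  descending []             _            = tt
  descending (k ∷ [])       _            = tt
  descending (k ∷ k′ ∷ ks) (adm , next) =
    T-∧⁺ (≤⇒≤ᵇ (s≤s (m≤n⇒m+m≤n+n (≤-trans (n≤1+n k′) next)))) (descending (k′ ∷ ks) adm)
  decreasing : ∀ ks → Admissible N ks → T (strictlyDecreasing (map value (map od ks)))
  decreasing []             _            = tt
  decreasing (k ∷ [])       _            = tt
  decreasing (k ∷ k′ ∷ ks) (adm , next) =
    T-∧⁺ (<⇒<ᵇ (s≤s (level<⇒value<ev (ev k′) k next))) (decreasing (k′ ∷ ks) adm)
  large : ∀ ks → Admissible N ks → T (allOddAtLeast (2 * N + 1) (map value (map od ks)))
  large []       _            = tt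
  large (k ∷ ks) (adm , next) = T-∧⁺ (subst T (sym (isOdd-value-od k)) tt)
    (T-∧⁺ (≤⇒≤ᵇ (subst (_≤ value (od k)) (sym (2N+1≡value N))
                  (s≤s (m≤n⇒m+m≤n+n (admissible-bound N ks k adm next)))))
          (large ks adm))

-- The bijection

insertOdds : List ℕ × List ℕ → List ℕ
insertOdds (π , ζ) = map value (insertAll (map toPart π) (map (level ∘ toPart) ζ))

insertOdds-encoded : ∀ P ks → insertOdds (map value P , map value (map od ks)) ≡ map value (insertAll P ks)
insertOdds-encoded P ks = cong₂ (λ P′ ks′ → map value (insertAll P′ ks′)) (map-toPart-value P) (levels ks)
  where
  levels : ∀ ks → map (level ∘ toPart) (map value (map od ks)) ≡ ks
  levels []       = refl
  levels (k ∷ ks) = cong₂ _∷_ (cong level (toPart-value (od k))) (levels ks)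

record Decoded (π ζ : List ℕ) : Set where
  constructor decoded
  field
    parts      : List Part
    levels     : List ℕ
    valid      : Valid parts
    even       : AllEven parts
    admissible : Admissible (threshold parts) levels
    π≡         : π ≡ map value parts
    ζ≡         : ζ ≡ map value (map od levels)

decode : ∀ π ζ → InF33 (π , ζ) → Decoded π ζ
decode π ζ h with T-∧⁻ {isE33 π} h
... | inE , inI with T-∧⁻ {isC33 π} inE | isI⇒admissible (N₂ π) ζ inI
... | inC , allEv | ks , ζ≡ , adm =
  decoded P ks valid even (subst (λ N → Admissible N ks) N₂≡ adm) (sym (map-value-toPart π)) ζ≡
  where
  P : List Part
  P = map toPart π
  valid : Valid P
  valid = isC33⇒valid P (subst (T ∘ isC33) (sym (map-value-toPart π)) inC)
  even : AllEven P
  even = allEven⇒AllEven P (subst (T ∘ allEven) (sym (map-value-toPart π)) allEv)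
  N₂≡ : N₂ π ≡ threshold P
  N₂≡ = trans (cong N₂ (sym (map-value-toPart π))) (N₂-threshold P even valid)

encoded-InF33 : ∀ P ks → Valid P → AllEven P → Admissible (threshold P) ks →
  InF33 (map value P , map value (map od ks))
encoded-InF33 P ks valid even adm =
  T-∧⁺ (T-∧⁺ (valid⇒isC33 P valid) (AllEven⇒allEven P even))
       (subst (λ N → T (isI N (map value (map od ks)))) (sym (N₂-threshold P even valid))
              (admissible⇒isI (threshold P) ks adm))

insertOdds-sound : (π ζ : List ℕ) → InF33 (π , ζ) →
  InC33 (insertOdds (π , ζ)) × size (insertOdds (π , ζ)) ≡ size π + size ζ ×
  len (insertOdds (π , ζ)) ≡ len π + len ζ
insertOdds-sound π ζ h with decode π ζ h
... | decoded P ks valid even adm refl refl rewrite insertOdds-encoded P ks =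
  valid⇒isC33 (insertAll P ks) (proj₁ (insertAll-valid P ks valid adm)) ,
  total-insertAll P ks valid adm ,
  (begin
    length (map value (insertAll P ks))            ≡⟨ length-map value (insertAll P ks) ⟩
    length (insertAll P ks)                        ≡⟨ length-insertAll P ks ⟩
    length P + length ks                           ≡⟨ cong₂ _+_ (length-map value P) lengthOdd ⟨
    length (map value P) + length (map value (map od ks)) ∎)
  where
  lengthOdd : length (map value (map od ks)) ≡ length ks
  lengthOdd = trans (length-map value (map od ks)) (length-map od ks)

insertOdds-injective : (x y : List ℕ × List ℕ) → InF33 x → InF33 y → insertOdds x ≡ insertOdds y → x ≡ y
insertOdds-injective (π₁ , ζ₁) (π₂ , ζ₂) h₁ h₂ eq with decode π₁ ζ₁ h₁ | decode π₂ ζ₂ h₂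
... | decoded P₁ ks₁ v₁ e₁ adm₁ refl refl | decoded P₂ ks₂ v₂ e₂ adm₂ refl refl
  with insertAll-injective P₁ P₂ ks₁ ks₂ v₁ v₂ e₁ e₂ adm₁ adm₂
         (map-value-injective (trans (sym (insertOdds-encoded P₁ ks₁)) (trans eq (insertOdds-encoded P₂ ks₂))))
... | refl , refl = refl

insertOdds-surjective : (ω : List ℕ) → InC33 ω → ∃ λ x → InF33 x × insertOdds x ≡ ω
insertOdds-surjective ω h with insertAll-surjective (length (map toPart ω)) (map toPart ω) ≤-refl
                        (isC33⇒valid (map toPart ω) (subst InC33 (sym (map-value-toPart ω)) h))
... | P , ks , valid , even , adm , eq =
  (map value P , map value (map od ks)) , encoded-InF33 P ks valid even adm ,
  trans (insertOdds-encoded P ks) (trans (cong (map value) eq) (map-value-toPart ω))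

theorem5p1 : Σ (List ℕ × List ℕ → List ℕ) λ Φ →
    -- Φ maps 𝔽(3,3) into ℂ(3,3), preserving size and adding lengths
    ((π ζ : List ℕ) → InF33 (π , ζ) →
        InC33 (Φ (π , ζ))
        × size (Φ (π , ζ)) ≡ size π + size ζ
        × len (Φ (π , ζ)) ≡ len π + len ζ)
    -- Φ is injective on 𝔽(3,3)
    × ((x y : List ℕ × List ℕ) → InF33 x → InF33 y → Φ x ≡ Φ y → x ≡ y)
    -- Φ maps 𝔽(3,3) onto ℂ(3,3)
    × ((ω : List ℕ) → InC33 ω → ∃ λ x → InF33 x × Φ x ≡ ω)
theorem5p1 = insertOdds , insertOdds-sound , insertOdds-injective , insertOdds-surjective
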